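{- Let $r\ge1$ be an integer. There exists a routing algorithm for $r$-central routing on the full-duplex infinite hexagonal grid (store-and-forward $\Delta$-port model) that delivers all packets in $\binom{r+1}{2}$ steps, and no schedule can deliver all packets in fewer than $\binom{r+1}{2}$ steps.
   Context: Hexagonal grid: the infinite 3-regular graph formed by the vertices and edges of the regular hexagonal tiling of the plane (honeycomb lattice). $r$-central routing: a central node $v$ is fixed and every node at distance between $1$ and $r$ from $v$ holds exactly one packet whose destination is $v$. Routing model: time proceeds in synchronous steps; in each step each packet either stays at its current node (unbounded queues) or moves along one incident edge; a node may use all its incident edges simultaneously; full-duplex: each edge can be traversed by at most one packet per step in each direction. The running time is the number of steps until all packets have reached their destination. -}

module Defs where

open import Data.Nat as ℕ using (ℕ; zero; suc)
open import Data.Integer as ℤ using (ℤ; +_)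
open import Data.Integer.Divisibility using (_∣_)
open import Data.Product using (Σ; ∃; _×_; _,_)
open import Data.Sum using (_⊎_)
open import Relation.Binary.PropositionalEquality using (_≡_; _≢_)
open import Relation.Nullary using (¬_)

-- Honeycomb lattice in "brick wall" coordinates: vertices ℤ × ℤ,
-- horizontal edges (x,y)–(x+1,y) always, vertical edge (x,y)–(x,y+1)
-- exactly when x + y is even.  Every vertex has degree 3.
Node : Set
Node = ℤ × ℤ

data Adj : Node → Node → Set where
  right : ∀ x y → Adj (x , y) (x ℤ.+ + 1 , y)
  left  : ∀ x y → Adj (x ℤ.+ + 1 , y) (x , y)
  up    : ∀ x y → + 2 ∣ (x ℤ.+ y) → Adj (x , y) (x , y ℤ.+ + 1)
  down  : ∀ x y → + 2 ∣ (x ℤ.+ y) → Adj (x , y ℤ.+ + 1) (x , y)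

data Walk : Node → Node → ℕ → Set where
  here : ∀ {u} → Walk u u 0
  step : ∀ {u w z n} → Adj u w → Walk w z n → Walk u z (suc n)

Dist : Node → Node → ℕ → Set
Dist u w k = Walk u w k × (∀ m → Walk u w m → k ℕ.≤ m)

HasPacket : Node → ℕ → Node → Set
HasPacket v r w = ∃ λ k → Dist v w k × (1 ℕ.≤ k) × (k ℕ.≤ r)

Move : Node → Node → Set
Move a b = a ≡ b ⊎ Adj a b

-- A store-and-forward schedule for r-central routing towards v
-- (full-duplex, Δ-port, unbounded queues).  The packet originating at
-- node w is at node (pos w t) after t steps.
record Schedule (v : Node) (r : ℕ) : Set where
  field
    pos   : Node → ℕ → Node
    start : ∀ w → pos w 0 ≡ w
    moves : ∀ w t → Move (pos w t) (pos w (suc t))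
    -- each directed edge is used by at most one packet per step
    capacity : ∀ w w′ t → HasPacket v r w → HasPacket v r w′ →
               pos w t ≢ pos w (suc t) →
               pos w t ≡ pos w′ t → pos w (suc t) ≡ pos w′ (suc t) →
               w ≡ w′

Delivers : ∀ {v r} → Schedule v r → ℕ → Set
Delivers {v} {r} s T = ∀ w → HasPacket v r w → Schedule.pos s w T ≡ v

-- Writing tri r = 1 + ⋯ + r = (r+1 choose 2), there are 3k nodes at distance k
-- from the destination v, so 3 · tri r packets, and v has only three incoming
-- edges, each carrying one packet per step: hence at least tri r steps.
-- Conversely, a shortest-path tree towards v splits the grid into three
-- congruent sectors, each with k nodes at distance k.  Numbering the nodes of
-- a sector layer by layer gives slots 1, …, tri r; the packet with slot s
-- waits, then climbs the tree and arrives exactly at time s.  Packets sharing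
-- an edge at the same time lie in one sector and have the same slot, so the
-- edge capacity is respected.

module Submission where

open import Defs
open import Data.Nat using (ℕ; suc; _≤_)
open import Data.Nat.Combinatorics using (_C_)
open import Data.Product using (Σ; _×_; _,_)
open import Relation.Binary.PropositionalEquality using (subst; sym)

module Triangle where

  open import Data.Nat as ℕ using (ℕ; zero; suc; _+_; _∸_; _≤_; _<_; z≤n; s≤s)
  import Data.Nat.Properties as ℕP
  open import Data.Nat.Combinatorics using (_C_; nC1≡n; nCk+nC[k+1]≡[n+1]C[k+1])
  open import Data.Product using (_×_; _,_)
  open import Data.Empty using (⊥-elim)
  open import Relation.Binary.PropositionalEquality
  open import Relation.Binary.Definitions using (tri<; tri≈; tri>)
  open import Relation.Nullary using (yes; no)

  tri : ℕ → ℕ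
  tri zero = 0
  tri (suc n) = tri n + suc n

  tri≡C : ∀ n → suc n C 2 ≡ tri n
  tri≡C zero = refl
  tri≡C (suc n) = begin
    suc (suc n) C 2        ≡⟨ nCk+nC[k+1]≡[n+1]C[k+1] (suc n) 1 ⟨
    suc n C 1 + suc n C 2  ≡⟨ cong₂ _+_ (nC1≡n (suc n)) (tri≡C n) ⟩
    suc n + tri n          ≡⟨ ℕP.+-comm (suc n) (tri n) ⟩
    tri n + suc n          ∎
    where open ≡-Reasoning

  tri-mono : ∀ {m n} → m ≤ n → tri m ≤ tri n
  tri-mono {n = zero} z≤n = z≤n
  tri-mono {zero} {suc n} _ = z≤n
  tri-mono {suc m} {suc n} (s≤s m≤n) = ℕP.+-mono-≤ (tri-mono m≤n) (s≤s m≤n)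

  row-before : ∀ {m i m′} i′ → i ≤ m → m < m′ → tri m + i < tri m′ + i′
  row-before {m} {i} {m′} i′ i≤m m<m′ = begin-strict
    tri m + i       <⟨ ℕP.+-monoʳ-< (tri m) (s≤s i≤m) ⟩
    tri (suc m)     ≤⟨ tri-mono m<m′ ⟩
    tri m′          ≤⟨ ℕP.m≤m+n (tri m′) i′ ⟩
    tri m′ + i′     ∎
    where open ℕP.≤-Reasoning

  triangle-injective : ∀ {m i m′ i′} → i ≤ m → i′ ≤ m′ →
                       tri m + i ≡ tri m′ + i′ → m ≡ m′ × i ≡ i′
  triangle-injective {m} {i} {m′} {i′} i≤m i′≤m′ eq with ℕP.<-cmp m m′
  ... | tri< m<m′ _ _ = ⊥-elim (ℕP.<-irrefl eq (row-before i′ i≤m m<m′))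
  ... | tri≈ _ refl _ = refl , ℕP.+-cancelˡ-≡ (tri m) i i′ eq
  ... | tri> _ _ m′<m = ⊥-elim (ℕP.<-irrefl (sym eq) (row-before i i′≤m′ m′<m))

  record Cell (r j : ℕ) : Set where
    field
      row      : ℕ
      column   : ℕ
      column≤row : column ≤ row
      row<r    : row < r
      position : tri row + column ≡ j

  triangle-surjective : ∀ r j → j < tri r → Cell r j
  triangle-surjective (suc r) j j<tri with j ℕP.<? tri r
  ... | yes j<tri′ = record { Cell (triangle-surjective r j j<tri′) ; row<r = ℕP.m≤n⇒m≤1+n (Cell.row<r (triangle-surjective r j j<tri′)) }
  ... | no j≮tri′ = record
    { row = r ; column = j ∸ tri r ; column≤row = i≤r ; row<r = ℕP.n<1+n r
    ; position = ℕP.m+[n∸m]≡n (ℕP.≮⇒≥ j≮tri′) }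
    where
    i≤r : j ∸ tri r ≤ r
    i≤r = ℕP.≤-pred (ℕP.+-cancelˡ-< (tri r) (j ∸ tri r) (suc r)
            (subst (_< tri r + suc r) (sym (ℕP.m+[n∸m]≡n (ℕP.≮⇒≥ j≮tri′))) j<tri))

  -- A node at distance n with index i < n is given the slot 1 + tri (n − 1) + i:
  -- this is at least n, and at most tri r when n ≤ r.
  n≤tri : ∀ n → n ≤ tri n
  n≤tri zero = z≤n
  n≤tri (suc n) = ℕP.m≤n+m (suc n) (tri n)

  height≤slot-shape : ∀ n i → n ≤ suc (tri (ℕ.pred n) + i)
  height≤slot-shape zero i = z≤n
  height≤slot-shape (suc m) i = s≤s (ℕP.≤-trans (n≤tri m) (ℕP.m≤m+n (tri m) i))

  slot≤tri-shape : ∀ {m i r} → i ≤ m → m < r → suc (tri m + i) ≤ tri r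
  slot≤tri-shape {m} {i} {r} i≤m m<r = begin
    suc (tri m + i)   ≡⟨ ℕP.+-suc (tri m) i ⟨
    tri m + suc i     ≤⟨ ℕP.+-monoʳ-≤ (tri m) (s≤s i≤m) ⟩
    tri (suc m)       ≤⟨ tri-mono m<r ⟩
    tri r             ∎
    where open ℕP.≤-Reasoning

module Routing where

  open import Data.Nat as ℕ using (ℕ; zero; suc; _+_; _*_; _∸_; _≤_; _<_; z≤n; s≤s; NonZero)
  import Data.Nat.Properties as ℕP
  import Data.Integer.Properties as ℤP
  open import Data.Fin as Fin using (Fin; toℕ; combine; remQuot)
  import Data.Fin.Properties as FinP
  open import Data.Product using (Σ; _×_; _,_; proj₁; proj₂; uncurry)
  open import Data.Product.Properties using (≡-dec)
  open import Data.Sum using (_⊎_; inj₁; inj₂)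
  open import Data.Empty using (⊥-elim)
  open import Function using (_∘_)
  open import Relation.Binary.PropositionalEquality
  open import Relation.Nullary using (¬_; Dec; yes; no)

  first-arrival : ∀ {P : ℕ → Set} → (∀ n → Dec (P n)) → ¬ P 0 →
                  ∀ T → P T → Σ (Fin T) λ τ → ¬ P (toℕ τ) × P (suc (toℕ τ))
  first-arrival P? ¬P0 zero P0 = ⊥-elim (¬P0 P0)
  first-arrival {P} P? ¬P0 (suc T) PT+1 with P? T
  ... | no ¬PT = Fin.fromℕ T , subst (¬_ ∘ P) (sym (FinP.toℕ-fromℕ T)) ¬PT
                             , subst (P ∘ suc) (sym (FinP.toℕ-fromℕ T)) PT+1
  ... | yes PT =
    let (τ , ¬Pτ , Pτ+1) = first-arrival P? ¬P0 T PT
    in Fin.inject₁ τ , subst (¬_ ∘ P) (sym (FinP.toℕ-inject₁ τ)) ¬Pτ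
                     , subst (P ∘ suc) (sym (FinP.toℕ-inject₁ τ)) Pτ+1

  _≟-node_ : (u w : Node) → Dec (u ≡ w)
  _≟-node_ = ≡-dec ℤP._≟_ ℤP._≟_

  Adj-sym : ∀ {u w} → Adj u w → Adj w u
  Adj-sym (right x y) = left x y
  Adj-sym (left x y) = right x y
  Adj-sym (up x y even) = down x y even
  Adj-sym (down x y even) = up x y even

  walk-snoc : ∀ {u w z n} → Walk u w n → Adj w z → Walk u z (suc n)
  walk-snoc here a = step a here
  walk-snoc (step a p) b = step a (walk-snoc p b)

  walk-reverse : ∀ {u w n} → Walk u w n → Walk w u n
  walk-reverse here = here
  walk-reverse (step a p) = walk-snoc (walk-reverse p) (Adj-sym a)

  packet≢root : ∀ {v r w} → HasPacket v r w → w ≢ v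
  packet≢root (k , (_ , minimal) , 1≤k , _) refl = ℕP.<-irrefl refl (ℕP.<-≤-trans 1≤k (minimal 0 here))

  -- The height is
  -- then the graph distance to v (see `distance` below).
  record DistanceTree (v : Node) : Set where
    field
      height        : Node → ℕ
      parent        : Node → Node
      root          : ∀ w → height w ≡ 0 → w ≡ v
      parent-root   : parent v ≡ v
      parent-adj    : ∀ w → 0 < height w → Adj w (parent w)
      height-parent : ∀ w → height (parent w) ≡ height w ∸ 1
      height-adj    : ∀ {u w} → Adj u w → height w ≤ suc (height u)

    -- the root has height 0, being its own parent
    height-root : height v ≡ 0
    height-root = fixed-point (trans (cong height (sym parent-root)) (height-parent v))
      where
      fixed-point : ∀ {n} → n ≡ n ∸ 1 → n ≡ 0
      fixed-point {zero} _ = refl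
      fixed-point {suc n} eq = ⊥-elim (ℕP.1+n≢n eq)

    climb : Node → ℕ → Node
    climb w zero = w
    climb w (suc n) = parent (climb w n)

    height-climb : ∀ w n → height (climb w n) ≡ height w ∸ n
    height-climb w zero = refl
    height-climb w (suc n) = begin
      height (parent (climb w n)) ≡⟨ height-parent (climb w n) ⟩
      height (climb w n) ∸ 1      ≡⟨ cong (_∸ 1) (height-climb w n) ⟩
      height w ∸ n ∸ 1            ≡⟨ ℕP.∸-+-assoc (height w) n 1 ⟩
      height w ∸ (n + 1)          ≡⟨ cong (height w ∸_) (ℕP.+-comm n 1) ⟩
      height w ∸ suc n            ∎
      where open ≡-Reasoning

    climb-arrives : ∀ w n → height w ≤ n → climb w n ≡ v
    climb-arrives w n h≤n = root (climb w n) (trans (height-climb w n) (ℕP.m≤n⇒m∸n≡0 h≤n))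

    walk-to-root : ∀ k w → height w ≡ k → Walk w v k
    walk-to-root zero w h≡0 = subst (λ u → Walk u v 0) (sym (root w h≡0)) here
    walk-to-root (suc k) w h≡k+1 =
      step (parent-adj w (subst (0 <_) (sym h≡k+1) (s≤s z≤n)))
           (walk-to-root k (parent w) (trans (height-parent w) (cong (_∸ 1) h≡k+1)))

    height-walk : ∀ {u w n} → Walk u w n → height w ≤ height u + n
    height-walk {u} here = ℕP.m≤m+n (height u) 0
    height-walk {u} {n = suc n} (step a p) = begin
      _                      ≤⟨ height-walk p ⟩
      height _ + n           ≤⟨ ℕP.+-monoˡ-≤ n (height-adj a) ⟩
      suc (height u) + n     ≡⟨ ℕP.+-suc (height u) n ⟨
      height u + suc n       ∎
      where open ℕP.≤-Reasoning

    distance : ∀ w → Dist v w (height w)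
    distance w = walk-reverse (walk-to-root (height w) w refl)
               , λ m p → subst (λ h → height w ≤ h + m) height-root (height-walk p)

    distance-unique : ∀ {w k} → Dist v w k → k ≡ height w
    distance-unique {w} {k} (p , minimal) =
      ℕP.≤-antisym (minimal (height w) (proj₁ (distance w)))
                   (subst (λ h → height w ≤ h + k) height-root (height-walk p))

    packet-height : ∀ {r w} → HasPacket v r w → 1 ≤ height w × height w ≤ r
    packet-height (k , d , 1≤k , k≤r) =
      subst (λ h → 1 ≤ h × h ≤ _) (distance-unique d) (1≤k , k≤r)

    height-packet : ∀ {r w} → 1 ≤ height w → height w ≤ r → HasPacket v r w
    height-packet {w = w} 1≤h h≤r = height w , distance w , 1≤h , h≤r

  -- A timetable on a distance tree: every node gets a colour (the subtree it
  -- lies in) and an arrival slot, no earlier than its height, such that distinct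
  -- nodes of the same colour have distinct slots.
  record Timetable {v : Node} (D : DistanceTree v) (Colour : Set) : Set where
    open DistanceTree D
    field
      colour         : Node → Colour
      slot           : Node → ℕ
      colour-parent  : ∀ w → 0 < height (parent w) → colour (parent w) ≡ colour w
      height≤slot    : ∀ w → height w ≤ slot w
      slot-injective : ∀ w w′ → 0 < height w → 0 < height w′ →
                       colour w ≡ colour w′ → slot w ≡ slot w′ → w ≡ w′

    -- The tree schedule: the packet of w waits until time slot w − height w and
    -- then climbs the tree, one edge per step, reaching v exactly at slot w.
    wait : Node → ℕ
    wait w = slot w ∸ height w

    position : Node → ℕ → Node
    position w t = climb w (t ∸ wait w)

    colour-climb : ∀ w n → 0 < height (climb w n) → colour (climb w n) ≡ colour w
    colour-climb w zero _ = refl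
    colour-climb w (suc n) 0<h = trans (colour-parent (climb w n) 0<h) (colour-climb w n 0<h′)
      where
      0<h′ : 0 < height (climb w n)
      0<h′ = ℕP.<-≤-trans 0<h (subst (_≤ height (climb w n))
               (sym (height-parent (climb w n))) (ℕP.m∸n≤m (height (climb w n)) 1))

    clock : ∀ w t → (suc t ∸ wait w ≡ t ∸ wait w) ⊎ (wait w ≤ t × suc t ∸ wait w ≡ suc (t ∸ wait w))
    clock w t with wait w ℕP.≤? t
    ... | yes W≤t = inj₂ (W≤t , ℕP.+-∸-assoc 1 W≤t)
    ... | no W≰t = inj₁ (trans (ℕP.m≤n⇒m∸n≡0 (ℕP.≰⇒> W≰t)) (sym (ℕP.m≤n⇒m∸n≡0 (ℕP.<⇒≤ (ℕP.≰⇒> W≰t)))))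

    parent-move : ∀ u → Move u (parent u)
    parent-move u with height u ℕ.≟ 0
    ... | yes h≡0 = inj₁ (sym (trans (cong parent (root u h≡0)) (trans parent-root (sym (root u h≡0)))))
    ... | no h≢0 = inj₂ (parent-adj u (ℕP.n≢0⇒n>0 h≢0))

    position-moves : ∀ w t → Move (position w t) (position w (suc t))
    position-moves w t with clock w t
    ... | inj₁ same = inj₁ (cong (climb w) (sym same))
    ... | inj₂ (_ , next) = subst (λ n → Move (position w t) (climb w n)) (sym next)
                                  (parent-move (position w t))

    record Moving (w : Node) (t : ℕ) : Set where
      field
        above-root : 0 < height (position w t)
        same-colour : colour (position w t) ≡ colour w
        on-time : slot w ≡ t + height (position w t)

    moving : ∀ w t → position w t ≢ position w (suc t) → Moving w t
    moving w t moves with clock w t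
    ... | inj₁ same = ⊥-elim (moves (cong (climb w) (sym same)))
    ... | inj₂ (W≤t , next) = record
      { above-root = 0<h ; same-colour = colour-climb w n 0<h ; on-time = arrival }
      where
      n = t ∸ wait w
      x = climb w n
      0<h : 0 < height x
      0<h with height x ℕ.≟ 0
      ... | yes h≡0 = ⊥-elim (moves (trans (root x h≡0) (sym (trans (cong (climb w) next)
                        (trans (cong parent (root x h≡0)) parent-root)))))
      ... | no h≢0 = ℕP.n≢0⇒n>0 h≢0
      n<h : n < height w
      n<h = ℕP.≰⇒> (λ h≤n → ℕP.<-irrefl (sym (trans (height-climb w n) (ℕP.m≤n⇒m∸n≡0 h≤n))) 0<h)
      arrival : slot w ≡ t + height x
      arrival = begin
        slot w                             ≡⟨ ℕP.m∸n+n≡m (height≤slot w) ⟨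
        wait w + height w                  ≡⟨ cong (wait w +_) (ℕP.m+[n∸m]≡n (ℕP.<⇒≤ n<h)) ⟨
        wait w + (n + (height w ∸ n))      ≡⟨ ℕP.+-assoc (wait w) n _ ⟨
        wait w + n + (height w ∸ n)        ≡⟨ cong₂ _+_ (ℕP.m+[n∸m]≡n W≤t) (sym (height-climb w n)) ⟩
        t + height x                       ∎
        where open ≡-Reasoning

    -- Two packets crossing the same edge at the same time meet at the same node,
    -- hence share colour and slot, and so are the same packet.
    one-packet-per-edge : ∀ w w′ t → position w t ≢ position w (suc t) →
      position w t ≡ position w′ t → position w (suc t) ≡ position w′ (suc t) → w ≡ w′
    one-packet-per-edge w w′ t moves here≡ next≡ =
      slot-injective w w′ (starts-above-root M) (starts-above-root M′)
        (trans (sym (Moving.same-colour M)) (trans (cong colour here≡) (Moving.same-colour M′)))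
        (trans (Moving.on-time M) (trans (cong (λ x → t + height x) here≡) (sym (Moving.on-time M′))))
      where
      M = moving w t moves
      M′ = moving w′ t (λ stays → moves (trans here≡ (trans stays (sym next≡))))
      starts-above-root : ∀ {u} → Moving u t → 0 < height u
      starts-above-root {u} m = ℕP.<-≤-trans (Moving.above-root m)
        (subst (_≤ height u) (sym (height-climb u (t ∸ wait u))) (ℕP.m∸n≤m (height u) (t ∸ wait u)))

    tree-schedule : ∀ r → Schedule v r
    tree-schedule r = record
      { pos = position
      ; start = λ w → cong (climb w) (ℕP.0∸n≡0 (wait w))
      ; moves = position-moves
      ; capacity = λ w w′ t _ _ → one-packet-per-edge w w′ t }

    tree-schedule-delivers : ∀ r T → (∀ w → HasPacket v r w → slot w ≤ T) →
                             Delivers (tree-schedule r) T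
    tree-schedule-delivers r T slot≤T w packet = climb-arrives w (T ∸ wait w)
      (ℕP.m+n≤o⇒m≤o∸n (height w)
        (subst (_≤ T) (trans (sym (ℕP.m∸n+n≡m (height≤slot w))) (ℕP.+-comm (wait w) (height w)))
               (slot≤T w packet)))

  -- Counting bound: if v has at most d neighbours and d·m distinct nodes hold
  -- packets, then every delivering schedule needs at least m steps, because at
  -- most d packets can enter v per step.  Each packet is mapped to the time and
  -- the edge of its final step, and this map is injective by edge capacity.
  lower-bound : ∀ {v r d m T} .{{_ : NonZero d}} (neighbour : Fin d → Node) →
    (∀ {X} → Adj X v → Σ (Fin d) λ i → X ≡ neighbour i) →
    (packet : Fin m × Fin d → Node) → (∀ p q → packet p ≡ packet q → p ≡ q) →
    (∀ p → HasPacket v r (packet p)) →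
    (s : Schedule v r) → Delivers s T → m ≤ T
  lower-bound {v} {r} {d} {m} {T} neighbour adj-neighbour packet packet-inj has-packet s delivers =
    ℕP.*-cancelʳ-≤ m T d (FinP.injective⇒≤ {f = encode ∘ remQuot d} encode∘remQuot-injective)
    where
    open Schedule s
    final-step : ∀ p → Σ (Fin T) λ τ → pos (packet p) (toℕ τ) ≢ v × pos (packet p) (suc (toℕ τ)) ≡ v
    final-step p = first-arrival (λ t → pos (packet p) t ≟-node v)
      (λ at-v → packet≢root (has-packet p) (trans (sym (start (packet p))) at-v))
      T (delivers (packet p) (has-packet p))
    time : Fin m × Fin d → Fin T
    time p = proj₁ (final-step p)
    last : Fin m × Fin d → Node
    last p = pos (packet p) (toℕ (time p))
    entry : ∀ p → Adj (last p) v
    entry p = move-into (proj₁ (proj₂ (final-step p)))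
      (subst (Move (last p)) (proj₂ (proj₂ (final-step p))) (moves (packet p) (toℕ (time p))))
      where
      move-into : ∀ {X} → X ≢ v → Move X v → Adj X v
      move-into X≢v (inj₁ X≡v) = ⊥-elim (X≢v X≡v)
      move-into X≢v (inj₂ a) = a
    encode : Fin m × Fin d → Fin (T * d)
    encode p = combine (time p) (proj₁ (adj-neighbour (entry p)))
    encode-injective : ∀ p q → encode p ≡ encode q → p ≡ q
    encode-injective p q eq with FinP.combine-injective (time p) _ (time q) _ eq
    ... | same-time , same-edge = packet-inj p q
          (capacity (packet p) (packet q) τ (has-packet p) (has-packet q) moves-p same-node same-next)
      where
      τ = toℕ (time p)
      same-node : last p ≡ pos (packet q) τ
      same-node = trans (proj₂ (adj-neighbour (entry p)))
        (trans (cong neighbour same-edge) (trans (sym (proj₂ (adj-neighbour (entry q))))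
          (cong (λ t → pos (packet q) (toℕ t)) (sym same-time))))
      same-next : pos (packet p) (suc τ) ≡ pos (packet q) (suc τ)
      same-next = trans (proj₂ (proj₂ (final-step p)))
        (sym (trans (cong (λ t → pos (packet q) (suc (toℕ t))) same-time) (proj₂ (proj₂ (final-step q)))))
      moves-p : last p ≢ pos (packet p) (suc τ)
      moves-p stays = proj₁ (proj₂ (final-step p)) (trans stays (proj₂ (proj₂ (final-step p))))
    encode∘remQuot-injective : ∀ {i j} → encode (remQuot d i) ≡ encode (remQuot d j) → i ≡ j
    encode∘remQuot-injective {i} {j} eq =
      trans (sym (FinP.combine-remQuot {m} d i))
            (trans (cong (uncurry combine) (encode-injective _ _ eq)) (FinP.combine-remQuot {m} d j))

module Parity where

  open import Data.Nat using (zero; suc)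
  open import Data.Integer using (ℤ; +_; -[1+_]; _+_; _-_; -_; _*_)
  import Data.Integer.Properties as ℤP
  open import Data.Integer.Tactic.RingSolver using (solve-∀)
  open import Algebra.Bundles using (AbelianGroup)
  open import Algebra.Properties.Group (AbelianGroup.group ℤP.+-0-abelianGroup)
    using () renaming (∙-cancelʳ to +-cancelʳ)
  open import Data.Integer.Divisibility using (_∣_)
  open import Data.Integer.Divisibility.Signed as Signed using (∣ᵤ⇒∣; ∣⇒∣ᵤ)
  open import Data.Bool using (Bool; true; false)
  open import Data.Product using (_×_; _,_; proj₂)
  open import Data.Empty using (⊥-elim)
  open import Relation.Binary.PropositionalEquality

  bitℤ : Bool → ℤ
  bitℤ false = + 0
  bitℤ true = + 1

  record Halving (z : ℤ) : Set where
    constructor halving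
    field
      half   : ℤ
      odd    : Bool
      halves : z ≡ half + half + bitℤ odd

  halve-ℕ : ∀ n → Halving (+ n)
  halve-ℕ zero = halving (+ 0) false refl
  halve-ℕ (suc zero) = halving (+ 0) true refl
  halve-ℕ (suc (suc n)) with halve-ℕ n
  ... | halving h b eq = halving (h + + 1) b (trans (cong (λ z → + 2 + z) eq) (two-more h (bitℤ b)))
    where
    two-more : ∀ (h β : ℤ) → + 2 + (h + h + β) ≡ (h + + 1) + (h + + 1) + β
    two-more = solve-∀

  halve : ∀ z → Halving z
  halve (+ n) = halve-ℕ n
  halve -[1+ n ] with halve-ℕ (suc n)
  ... | halving h false eq = halving (- h) false (trans (cong -_ eq) (negate-even h))
    where
    negate-even : ∀ (h : ℤ) → - (h + h + + 0) ≡ - h + - h + + 0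
    negate-even = solve-∀
  ... | halving h true eq = halving (- h - + 1) true (trans (cong -_ eq) (negate-odd h))
    where
    negate-odd : ∀ (h : ℤ) → - (h + h + + 1) ≡ (- h - + 1) + (- h - + 1) + + 1
    negate-odd = solve-∀

  half : ℤ → ℤ
  half z = Halving.half (halve z)

  odd : ℤ → Bool
  odd z = Halving.odd (halve z)

  halves : ∀ z → z ≡ half z + half z + bitℤ (odd z)
  halves z = Halving.halves (halve z)

  double-injective : ∀ h k → h + h ≡ k + k → h ≡ k
  double-injective h k eq = ℤP.*-cancelˡ-≡ (+ 2) h k (trans (twice h) (trans eq (sym (twice k))))
    where
    twice : ∀ (x : ℤ) → + 2 * x ≡ x + x
    twice = solve-∀

  -- an even number is not odd: t + t = 1 has no integer solution
  even≢odd : ∀ h k → h + h ≢ k + k + + 1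
  even≢odd h k eq = no-half (h - k) (trans (difference h k) (trans (cong (λ z → z - k - k) eq) (cancel k)))
    where
    no-half : ∀ t → t + t ≢ + 1
    no-half (+ zero) ()
    no-half (+ suc zero) ()
    no-half (+ suc (suc n)) ()
    no-half -[1+ n ] ()
    difference : ∀ (h k : ℤ) → (h - k) + (h - k) ≡ h + h - k - k
    difference = solve-∀
    cancel : ∀ (k : ℤ) → k + k + + 1 - k - k ≡ + 1
    cancel = solve-∀

  halving-unique : ∀ {h b k c} → h + h + bitℤ b ≡ k + k + bitℤ c → h ≡ k × b ≡ c
  halving-unique {h} {false} {k} {false} eq = double-injective h k (+-cancelʳ (+ 0) _ _ eq) , refl
  halving-unique {h} {true} {k} {true} eq = double-injective h k (+-cancelʳ (+ 1) _ _ eq) , refl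
  halving-unique {h} {false} {k} {true} eq = ⊥-elim (even≢odd h k (trans (sym (ℤP.+-identityʳ (h + h))) eq))
  halving-unique {h} {true} {k} {false} eq = ⊥-elim (even≢odd k h (trans (sym (ℤP.+-identityʳ (k + k))) (sym eq)))

  half-odd-unique : ∀ {z h b} → z ≡ h + h + bitℤ b → half z ≡ h × odd z ≡ b
  half-odd-unique {z} eq = halving-unique (trans (sym (halves z)) eq)

  even⇒halves : ∀ {z} → + 2 ∣ z → z ≡ half z + half z + + 0
  even⇒halves {z} two∣z with ∣ᵤ⇒∣ {+ 2} {z} two∣z
  ... | Signed.divides q eq = trans (halves z) (cong (λ b → half z + half z + bitℤ b)
          (proj₂ (half-odd-unique {z} {q} {false} (trans eq (doubled q)))))
    where
    doubled : ∀ (q : ℤ) → q * + 2 ≡ q + q + + 0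
    doubled = solve-∀

  double⇒even : ∀ {z} h → z ≡ h + h → + 2 ∣ z
  double⇒even {z} h eq = ∣⇒∣ᵤ (Signed.divides h (trans eq (doubled h)))
    where
    doubled : ∀ (h : ℤ) → h + h ≡ h * + 2
    doubled = solve-∀

module CubeCoordinates where

  open Parity
  open import Data.Nat as ℕ using (ℕ; zero; suc; _≤_)
  import Data.Nat.Properties as ℕP
  open import Data.Nat.Tactic.RingSolver as ℕSolver using ()
  open import Data.Integer using (ℤ; +_; -[1+_]; +[1+_]; _+_; -_; ∣_∣)
  import Data.Integer.Properties as ℤP
  open import Data.Integer.Tactic.RingSolver using (solve-∀)
  open import Data.Bool using (Bool)
  open import Data.Fin using (Fin)
  open import Data.Fin.Patterns using (0F; 1F; 2F)
  open import Data.Product using (Σ; _,_)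
  open import Relation.Binary.PropositionalEquality

  -- The honeycomb is isomorphic to the graph on the integer
  -- points p = ⟨ a , b , c ⟩ of level a + b + c ∈ {0, 1} in which every point
  -- of level 0 is joined to its three successors p + eᵢ.  In these coordinates
  -- the graph distance to the origin is the ℓ¹-norm |a| + |b| + |c|.
  record Cube : Set where
    constructor ⟨_,_,_⟩
    field
      ca cb cc : ℤ
  open Cube public

  cube-eq : ∀ {a b c a′ b′ c′} → a ≡ a′ → b ≡ b′ → c ≡ c′ → ⟨ a , b , c ⟩ ≡ ⟨ a′ , b′ , c′ ⟩
  cube-eq refl refl refl = refl

  origin : Cube
  origin = ⟨ + 0 , + 0 , + 0 ⟩

  infixl 6 _⊕_
  _⊕_ : Cube → Cube → Cube
  p ⊕ q = ⟨ ca p + ca q , cb p + cb q , cc p + cc q ⟩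

  ⊝_ : Cube → Cube
  ⊝ p = ⟨ - ca p , - cb p , - cc p ⟩

  level : Cube → ℤ
  level p = ca p + cb p + cc p

  norm : Cube → ℕ
  norm p = ∣ ca p ∣ ℕ.+ ∣ cb p ∣ ℕ.+ ∣ cc p ∣

  unit : Fin 3 → Cube
  unit 0F = ⟨ + 1 , + 0 , + 0 ⟩
  unit 1F = ⟨ + 0 , + 1 , + 0 ⟩
  unit 2F = ⟨ + 0 , + 0 , + 1 ⟩

  coordinate : Fin 3 → Cube → ℤ
  coordinate 0F = ca
  coordinate 1F = cb
  coordinate 2F = cc

  Valid : Cube → Set
  Valid p = Σ Bool λ t → level p ≡ bitℤ t

  data CubeAdj : Cube → Cube → Set where
    ascend  : ∀ p i → level p ≡ + 0 → CubeAdj p (p ⊕ unit i)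
    descend : ∀ p i → level p ≡ + 1 → CubeAdj p (p ⊕ ⊝ unit i)

  cube-adj-cong : ∀ {p p′ q q′} → p ≡ p′ → q ≡ q′ → CubeAdj p q → CubeAdj p′ q′
  cube-adj-cong refl refl a = a

  ⊕-assoc : ∀ p q r → p ⊕ q ⊕ r ≡ p ⊕ (q ⊕ r)
  ⊕-assoc p q r = cube-eq (ℤP.+-assoc (ca p) _ _) (ℤP.+-assoc (cb p) _ _) (ℤP.+-assoc (cc p) _ _)

  level-⊕ : ∀ p q → level (p ⊕ q) ≡ level p + level q
  level-⊕ p q = regroup (ca p) (cb p) (cc p) (ca q) (cb q) (cc q)
    where
    regroup : ∀ (a b c a′ b′ c′ : ℤ) → (a + a′) + (b + b′) + (c + c′) ≡ (a + b + c) + (a′ + b′ + c′)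
    regroup = solve-∀

  level-⊝ : ∀ p → level (⊝ p) ≡ - level p
  level-⊝ p = negate (ca p) (cb p) (cc p)
    where
    negate : ∀ (a b c : ℤ) → - a + - b + - c ≡ - (a + b + c)
    negate = solve-∀

  ⊕-⊝-cancel : ∀ p q → p ⊕ q ⊕ ⊝ q ≡ p
  ⊕-⊝-cancel p q = cube-eq (cancel (ca p) (ca q)) (cancel (cb p) (cb q)) (cancel (cc p) (cc q))
    where
    cancel : ∀ (x y : ℤ) → x + y + - y ≡ x
    cancel = solve-∀

  ⊕-⊝-cancel′ : ∀ p q → p ⊕ ⊝ q ⊕ q ≡ p
  ⊕-⊝-cancel′ p q = cube-eq (cancel (ca p) (ca q)) (cancel (cb p) (cb q)) (cancel (cc p) (cc q))
    where
    cancel : ∀ (x y : ℤ) → x + - y + y ≡ x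
    cancel = solve-∀

  CubeAdj-sym : ∀ {p q} → CubeAdj p q → CubeAdj q p
  CubeAdj-sym (ascend p i lvl) = cube-adj-cong refl (⊕-⊝-cancel p (unit i))
    (descend (p ⊕ unit i) i (trans (level-⊕ p (unit i)) (trans (cong (_+ level (unit i)) lvl) (level-unit i))))
    where
    level-unit : ∀ i → + 0 + level (unit i) ≡ + 1
    level-unit 0F = refl
    level-unit 1F = refl
    level-unit 2F = refl
  CubeAdj-sym (descend p i lvl) = cube-adj-cong refl (⊕-⊝-cancel′ p (unit i))
    (ascend (p ⊕ ⊝ unit i) i (trans (level-⊕ p (⊝ unit i)) (trans (cong (_+ level (⊝ unit i)) lvl) (level-⊝unit i))))
    where
    level-⊝unit : ∀ i → + 1 + level (⊝ unit i) ≡ + 0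
    level-⊝unit 0F = refl
    level-⊝unit 1F = refl
    level-⊝unit 2F = refl

  norm-⊕ : ∀ p q → norm (p ⊕ q) ≤ norm p ℕ.+ norm q
  norm-⊕ p q = begin
    norm (p ⊕ q)
      ≤⟨ ℕP.+-mono-≤ (ℕP.+-mono-≤ (ℤP.∣i+j∣≤∣i∣+∣j∣ (ca p) (ca q)) (ℤP.∣i+j∣≤∣i∣+∣j∣ (cb p) (cb q)))
                     (ℤP.∣i+j∣≤∣i∣+∣j∣ (cc p) (cc q)) ⟩
    ((∣ ca p ∣) ℕ.+ (∣ ca q ∣)) ℕ.+ ((∣ cb p ∣) ℕ.+ (∣ cb q ∣)) ℕ.+ ((∣ cc p ∣) ℕ.+ (∣ cc q ∣))
      ≡⟨ regroup (∣ ca p ∣) (∣ cb p ∣) (∣ cc p ∣) (∣ ca q ∣) (∣ cb q ∣) (∣ cc q ∣) ⟩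
    norm p ℕ.+ norm q ∎
    where
    open ℕP.≤-Reasoning
    regroup : ∀ a b c a′ b′ c′ → (a ℕ.+ a′) ℕ.+ (b ℕ.+ b′) ℕ.+ (c ℕ.+ c′) ≡ (a ℕ.+ b ℕ.+ c) ℕ.+ (a′ ℕ.+ b′ ℕ.+ c′)
    regroup = ℕSolver.solve-∀

  norm-step : ∀ p δ → norm δ ≡ 1 → norm (p ⊕ δ) ≤ suc (norm p)
  norm-step p δ ∣δ∣≡1 = subst (norm (p ⊕ δ) ≤_)
    (trans (cong (norm p ℕ.+_) ∣δ∣≡1) (ℕP.+-comm (norm p) 1)) (norm-⊕ p δ)

  norm-adj : ∀ {p q} → CubeAdj p q → norm q ≤ suc (norm p)
  norm-adj (ascend p i _) = norm-step p (unit i) (norm-unit i)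
    where
    norm-unit : ∀ i → norm (unit i) ≡ 1
    norm-unit 0F = refl
    norm-unit 1F = refl
    norm-unit 2F = refl
  norm-adj (descend p i _) = norm-step p (⊝ unit i) (norm-⊝unit i)
    where
    norm-⊝unit : ∀ i → norm (⊝ unit i) ≡ 1
    norm-⊝unit 0F = refl
    norm-⊝unit 1F = refl
    norm-⊝unit 2F = refl

  norm-zero : ∀ p → norm p ≡ 0 → p ≡ origin
  norm-zero p n≡0 = cube-eq (ℤP.∣i∣≡0⇒i≡0 (ℕP.m+n≡0⇒m≡0 (∣ ca p ∣) ab≡0))
                            (ℤP.∣i∣≡0⇒i≡0 (ℕP.m+n≡0⇒n≡0 (∣ ca p ∣) ab≡0))
                            (ℤP.∣i∣≡0⇒i≡0 (ℕP.m+n≡0⇒n≡0 (∣ ca p ∣ ℕ.+ ∣ cb p ∣) n≡0))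
    where
    ab≡0 : ∣ ca p ∣ ℕ.+ ∣ cb p ∣ ≡ 0
    ab≡0 = ℕP.m+n≡0⇒m≡0 (∣ ca p ∣ ℕ.+ ∣ cb p ∣) n≡0

  from-origin : ∀ {q} → CubeAdj origin q → Σ (Fin 3) λ i → q ≡ origin ⊕ unit i
  from-origin (ascend _ i _) = i , refl

  rotate : Cube → Cube
  rotate p = ⟨ cc p , ca p , cb p ⟩

  rotate-level : ∀ p → level (rotate p) ≡ level p
  rotate-level p = cycle (ca p) (cb p) (cc p)
    where
    cycle : ∀ (a b c : ℤ) → c + a + b ≡ a + b + c
    cycle = solve-∀

  rotate-norm : ∀ p → norm (rotate p) ≡ norm p
  rotate-norm p = cycle (∣ ca p ∣) (∣ cb p ∣) (∣ cc p ∣)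
    where
    cycle : ∀ a b c → c ℕ.+ a ℕ.+ b ≡ a ℕ.+ b ℕ.+ c
    cycle = ℕSolver.solve-∀

  rotate-adj : ∀ {p q} → CubeAdj p q → CubeAdj (rotate p) (rotate q)
  rotate-adj (ascend p 0F lvl) = ascend (rotate p) 1F (trans (rotate-level p) lvl)
  rotate-adj (ascend p 1F lvl) = ascend (rotate p) 2F (trans (rotate-level p) lvl)
  rotate-adj (ascend p 2F lvl) = ascend (rotate p) 0F (trans (rotate-level p) lvl)
  rotate-adj (descend p 0F lvl) = descend (rotate p) 1F (trans (rotate-level p) lvl)
  rotate-adj (descend p 1F lvl) = descend (rotate p) 2F (trans (rotate-level p) lvl)
  rotate-adj (descend p 2F lvl) = descend (rotate p) 0F (trans (rotate-level p) lvl)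

  one-step : ∀ n → ∣ -[1+ n ] + + 1 ∣ ≡ n
  one-step zero = refl
  one-step (suc n) = refl

  closer-descend : ∀ p i n → coordinate i p ≡ +[1+ n ] → suc (norm (p ⊕ ⊝ unit i)) ≡ norm p
  closer-descend ⟨ a , b , c ⟩ 0F n refl
    rewrite ℤP.+-identityʳ b | ℤP.+-identityʳ c = refl
  closer-descend ⟨ a , b , c ⟩ 1F n refl
    rewrite ℤP.+-identityʳ a | ℤP.+-identityʳ c = cong (ℕ._+ ∣ c ∣) (sym (ℕP.+-suc ∣ a ∣ n))
  closer-descend ⟨ a , b , c ⟩ 2F n refl
    rewrite ℤP.+-identityʳ a | ℤP.+-identityʳ b = sym (ℕP.+-suc (∣ a ∣ ℕ.+ ∣ b ∣) n)

  closer-ascend : ∀ p i n → coordinate i p ≡ -[1+ n ] → suc (norm (p ⊕ unit i)) ≡ norm p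
  closer-ascend ⟨ a , b , c ⟩ 0F n refl
    rewrite ℤP.+-identityʳ b | ℤP.+-identityʳ c | one-step n = refl
  closer-ascend ⟨ a , b , c ⟩ 1F n refl
    rewrite ℤP.+-identityʳ a | ℤP.+-identityʳ c | one-step n = cong (ℕ._+ ∣ c ∣) (sym (ℕP.+-suc ∣ a ∣ n))
  closer-ascend ⟨ a , b , c ⟩ 2F n refl
    rewrite ℤP.+-identityʳ a | ℤP.+-identityʳ b | one-step n = sym (ℕP.+-suc (∣ a ∣ ℕ.+ ∣ b ∣) n)

  record ParentStep (p q : Cube) : Set where
    field
      edge   : CubeAdj p q
      closer : suc (norm q) ≡ norm p

  step-descend : ∀ {p q} i n → level p ≡ + 1 → coordinate i p ≡ +[1+ n ] → p ⊕ ⊝ unit i ≡ q → ParentStep p q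
  step-descend {p} i n lvl coord refl = record { edge = descend p i lvl ; closer = closer-descend p i n coord }

  step-ascend : ∀ {p q} i n → level p ≡ + 0 → coordinate i p ≡ -[1+ n ] → p ⊕ unit i ≡ q → ParentStep p q
  step-ascend {p} i n lvl coord refl = record { edge = ascend p i lvl ; closer = closer-ascend p i n coord }

module Charts where

  open Parity
  open CubeCoordinates
  open import Data.Integer using (ℤ; +_; _+_; _-_; -_)
  import Data.Integer.Properties as ℤP
  open import Data.Integer.Tactic.RingSolver using (solve-∀)
  open import Data.Integer.Divisibility using (_∣_)
  open import Data.Bool using (true; false)
  open import Data.Fin.Patterns using (0F; 1F; 2F)
  open import Data.Product using (_,_)
  open import Function using (_∘_)
  open import Relation.Binary.PropositionalEquality

  -- The brick-wall coordinates of a cube point, and back.  The column is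
  -- c − b and the row is a; the parity of x + y equals the level.
  fromCube₀ : Cube → Node
  fromCube₀ p = (cc p - cb p , ca p)

  toCube₀ : Node → Cube
  toCube₀ (x , y) = ⟨ y , - half (x + y) , bitℤ (odd (x + y)) + half (x + y) - y ⟩

  toCube₀-spec : ∀ x y {h} t → x + y ≡ h + h + bitℤ t → toCube₀ (x , y) ≡ ⟨ y , - h , bitℤ t + h - y ⟩
  toCube₀-spec x y t eq with half-odd-unique eq
  ... | h-eq , t-eq = cube-eq refl (cong -_ h-eq) (cong₂ (λ β k → bitℤ β + k - y) t-eq h-eq)

  fromCube₀-toCube₀ : ∀ u → fromCube₀ (toCube₀ u) ≡ u
  fromCube₀-toCube₀ (x , y) = cong (_, y) (begin
    bitℤ t + h - y - - h  ≡⟨ regroup (bitℤ t) h y ⟩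
    (h + h + bitℤ t) - y  ≡⟨ cong (_- y) (halves (x + y)) ⟨
    x + y - y             ≡⟨ cancel x y ⟩
    x                     ∎)
    where
    open ≡-Reasoning
    h = half (x + y)
    t = odd (x + y)
    regroup : ∀ (β h y : ℤ) → β + h - y - - h ≡ h + h + β - y
    regroup = solve-∀
    cancel : ∀ (x y : ℤ) → x + y - y ≡ x
    cancel = solve-∀

  toCube₀-fromCube₀ : ∀ p → Valid p → toCube₀ (fromCube₀ p) ≡ p
  toCube₀-fromCube₀ ⟨ a , b , c ⟩ (t , lvl) =
    trans (toCube₀-spec (c - b) a t (trans (column+row a b c) (cong (λ s → - b + - b + s) lvl)))
          (cube-eq refl (ℤP.neg-involutive b) (trans (cong (λ s → s + - b - a) (sym lvl)) (third a b c)))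
    where
    column+row : ∀ (a b c : ℤ) → c - b + a ≡ - b + - b + (a + b + c)
    column+row = solve-∀
    third : ∀ (a b c : ℤ) → a + b + c + - b - a ≡ c
    third = solve-∀

  toCube₀-valid : ∀ u → Valid (toCube₀ u)
  toCube₀-valid (x , y) = odd (x + y) , sum y (half (x + y)) (bitℤ (odd (x + y)))
    where
    sum : ∀ (y h β : ℤ) → y + - h + (β + h - y) ≡ β
    sum = solve-∀

  horizontal : ∀ x y {h} t → x + y ≡ h + h + bitℤ t → CubeAdj (toCube₀ (x , y)) (toCube₀ (x + + 1 , y))
  horizontal x y {h} false eq =
    cube-adj-cong (sym (toCube₀-spec x y false eq)) (trans (cube-eq (ℤP.+-identityʳ y) (ℤP.+-identityʳ (- h)) (shift h y))
                                                 (sym (toCube₀-spec (x + + 1) y true (trans (reorder x y) (trans (cong (_+ + 1) eq) (bump h))))))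
      (ascend _ 2F (level₀ h y))
    where
    shift : ∀ (h y : ℤ) → + 0 + h - y + + 1 ≡ + 1 + h - y
    shift = solve-∀
    reorder : ∀ (x y : ℤ) → x + + 1 + y ≡ x + y + + 1
    reorder = solve-∀
    bump : ∀ (h : ℤ) → h + h + + 0 + + 1 ≡ h + h + + 1
    bump = solve-∀
    level₀ : ∀ (h y : ℤ) → y + - h + (+ 0 + h - y) ≡ + 0
    level₀ = solve-∀
  horizontal x y {h} true eq =
    cube-adj-cong (sym (toCube₀-spec x y true eq)) (trans (cube-eq (ℤP.+-identityʳ y) (sym (ℤP.neg-distrib-+ h (+ 1))) (shift h y))
                                                 (sym (toCube₀-spec (x + + 1) y false (trans (reorder x y) (trans (cong (_+ + 1) eq) (carry h))))))
      (descend _ 1F (level₁ h y))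
    where
    shift : ∀ (h y : ℤ) → + 1 + h - y + - + 0 ≡ + 0 + (h + + 1) - y
    shift = solve-∀
    reorder : ∀ (x y : ℤ) → x + + 1 + y ≡ x + y + + 1
    reorder = solve-∀
    carry : ∀ (h : ℤ) → h + h + + 1 + + 1 ≡ (h + + 1) + (h + + 1) + + 0
    carry = solve-∀
    level₁ : ∀ (h y : ℤ) → y + - h + (+ 1 + h - y) ≡ + 1
    level₁ = solve-∀

  vertical : ∀ x y → + 2 ∣ (x + y) → CubeAdj (toCube₀ (x , y)) (toCube₀ (x , y + + 1))
  vertical x y even =
    cube-adj-cong (sym (toCube₀-spec x y false (even⇒halves {x + y} even)))
      (trans (cube-eq refl (ℤP.+-identityʳ (- h)) (shift h y))
             (sym (toCube₀-spec x (y + + 1) true (trans (reorder x y) (trans (cong (_+ + 1) (even⇒halves {x + y} even)) (bump h))))))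
      (ascend _ 0F (level₀ h y))
    where
    h = half (x + y)
    shift : ∀ (h y : ℤ) → + 0 + h - y + + 0 ≡ + 1 + h - (y + + 1)
    shift = solve-∀
    reorder : ∀ (x y : ℤ) → x + (y + + 1) ≡ x + y + + 1
    reorder = solve-∀
    bump : ∀ (h : ℤ) → h + h + + 0 + + 1 ≡ h + h + + 1
    bump = solve-∀
    level₀ : ∀ (h y : ℤ) → y + - h + (+ 0 + h - y) ≡ + 0
    level₀ = solve-∀

  toCube₀-adj : ∀ {u w} → Adj u w → CubeAdj (toCube₀ u) (toCube₀ w)
  toCube₀-adj (right x y) = horizontal x y {half (x + y)} (odd (x + y)) (halves (x + y))
  toCube₀-adj (left x y) = CubeAdj-sym (horizontal x y {half (x + y)} (odd (x + y)) (halves (x + y)))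
  toCube₀-adj (up x y even) = vertical x y even
  toCube₀-adj (down x y even) = CubeAdj-sym (vertical x y even)

  adj-cong : ∀ {u u′ w w′} → u ≡ u′ → w ≡ w′ → Adj u w → Adj u′ w′
  adj-cong refl refl a = a

  fromCube₀-adj : ∀ {p q} → CubeAdj p q → Adj (fromCube₀ p) (fromCube₀ q)
  fromCube₀-adj (ascend ⟨ a , b , c ⟩ 0F lvl) =
    adj-cong refl (cong (_, a + + 1) (pad c b))
      (up (c - b) a (double⇒even (- b) (trans (trans (column a b c) (cong (λ s → s - b - b) lvl)) (doubled b))))
    where
    pad : ∀ (c b : ℤ) → c - b ≡ c + + 0 - (b + + 0)
    pad = solve-∀
    column : ∀ (a b c : ℤ) → c - b + a ≡ a + b + c - b - b
    column = solve-∀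
    doubled : ∀ (b : ℤ) → + 0 - b - b ≡ - b + - b
    doubled = solve-∀
  fromCube₀-adj (ascend ⟨ a , b , c ⟩ 1F _) =
    adj-cong (cong (_, a) (shift c b)) (cong₂ _,_ (pad c b) (sym (ℤP.+-identityʳ a))) (left (c - (b + + 1)) a)
    where
    shift : ∀ (c b : ℤ) → c - (b + + 1) + + 1 ≡ c - b
    shift = solve-∀
    pad : ∀ (c b : ℤ) → c - (b + + 1) ≡ c + + 0 - (b + + 1)
    pad = solve-∀
  fromCube₀-adj (ascend ⟨ a , b , c ⟩ 2F _) =
    adj-cong refl (cong₂ _,_ (shift c b) (sym (ℤP.+-identityʳ a))) (right (c - b) a)
    where
    shift : ∀ (c b : ℤ) → c - b + + 1 ≡ c + + 1 - (b + + 0)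
    shift = solve-∀
  fromCube₀-adj (descend ⟨ a , b , c ⟩ 0F lvl) =
    adj-cong (cong (c - b ,_) (back a)) (cong (_, a - + 1) (pad c b))
      (down (c - b) (a - + 1) (double⇒even (- b) (trans (trans (column a b c) (cong (λ s → s - + 1 - b - b) lvl)) (doubled b))))
    where
    back : ∀ (a : ℤ) → a - + 1 + + 1 ≡ a
    back = solve-∀
    pad : ∀ (c b : ℤ) → c - b ≡ c + + 0 - (b + + 0)
    pad = solve-∀
    column : ∀ (a b c : ℤ) → c - b + (a - + 1) ≡ a + b + c - + 1 - b - b
    column = solve-∀
    doubled : ∀ (b : ℤ) → + 1 - + 1 - b - b ≡ - b + - b
    doubled = solve-∀
  fromCube₀-adj (descend ⟨ a , b , c ⟩ 1F _) =
    adj-cong refl (cong₂ _,_ (shift c b) (sym (ℤP.+-identityʳ a))) (right (c - b) a)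
    where
    shift : ∀ (c b : ℤ) → c - b + + 1 ≡ c + + 0 - (b - + 1)
    shift = solve-∀
  fromCube₀-adj (descend ⟨ a , b , c ⟩ 2F _) =
    adj-cong (cong (_, a) (shift c b)) (cong₂ _,_ (pad c b) (sym (ℤP.+-identityʳ a))) (left (c - + 1 - b) a)
    where
    shift : ∀ (c b : ℤ) → c - + 1 - b + + 1 ≡ c - b
    shift = solve-∀
    pad : ∀ (c b : ℤ) → c - + 1 - b ≡ c - + 1 - (b + + 0)
    pad = solve-∀

  record CubeSymmetry (c : Cube) : Set where
    field
      forth back   : Cube → Cube
      back-forth   : ∀ p → back (forth p) ≡ p
      forth-back   : ∀ p → forth (back p) ≡ p
      forth-valid  : ∀ {p} → Valid p → Valid (forth p)
      back-valid   : ∀ {p} → Valid p → Valid (back p)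
      forth-adj    : ∀ {p q} → CubeAdj p q → CubeAdj (forth p) (forth q)
      back-adj     : ∀ {p q} → CubeAdj p q → CubeAdj (back p) (back q)
      forth-origin : forth origin ≡ c

  translate-adj : ∀ c {p q} → level c ≡ + 0 → CubeAdj p q → CubeAdj (c ⊕ p) (c ⊕ q)
  translate-adj c lvl (ascend p i lvl′) =
    cube-adj-cong refl (⊕-assoc c p (unit i)) (ascend (c ⊕ p) i (trans (level-⊕ c p) (cong₂ _+_ lvl lvl′)))
  translate-adj c lvl (descend p i lvl′) =
    cube-adj-cong refl (⊕-assoc c p (⊝ unit i)) (descend (c ⊕ p) i (trans (level-⊕ c p) (cong₂ _+_ lvl lvl′)))

  translation : ∀ c → level c ≡ + 0 → CubeSymmetry c
  translation c lvl = record
    { forth = c ⊕_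
    ; back = ⊝ c ⊕_
    ; back-forth = λ p → cube-eq (cancel (ca c) (ca p)) (cancel (cb c) (cb p)) (cancel (cc c) (cc p))
    ; forth-back = λ p → cube-eq (cancel′ (ca c) (ca p)) (cancel′ (cb c) (cb p)) (cancel′ (cc c) (cc p))
    ; forth-valid = λ {p} (t , e) → t , trans (level-⊕ c p) (trans (cong₂ _+_ lvl e) (ℤP.+-identityˡ _))
    ; back-valid = λ {p} (t , e) → t , trans (level-⊕ (⊝ c) p)
                     (trans (cong₂ _+_ (trans (level-⊝ c) (cong -_ lvl)) e) (ℤP.+-identityˡ _))
    ; forth-adj = translate-adj c lvl
    ; back-adj = translate-adj (⊝ c) (trans (level-⊝ c) (cong -_ lvl))
    ; forth-origin = cube-eq (ℤP.+-identityʳ (ca c)) (ℤP.+-identityʳ (cb c)) (ℤP.+-identityʳ (cc c)) }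
    where
    cancel : ∀ (x y : ℤ) → - x + (x + y) ≡ y
    cancel = solve-∀
    cancel′ : ∀ (x y : ℤ) → x + (- x + y) ≡ y
    cancel′ = solve-∀

  reflect : Cube → Cube → Cube
  reflect c p = c ⊕ ⊝ p

  reflect-level : ∀ c p → level (reflect c p) ≡ level c - level p
  reflect-level c p = trans (level-⊕ c (⊝ p)) (cong (λ z → level c + z) (level-⊝ p))

  reflect-adj : ∀ c {p q} → level c ≡ + 1 → CubeAdj p q → CubeAdj (reflect c p) (reflect c q)
  reflect-adj c lvl (ascend p i lvl′) =
    cube-adj-cong refl (cube-eq (flip (ca c) (ca p) _) (flip (cb c) (cb p) _) (flip (cc c) (cc p) _))
      (descend (reflect c p) i (trans (reflect-level c p) (cong₂ _-_ lvl lvl′)))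
    where
    flip : ∀ (x y z : ℤ) → x + - y + - z ≡ x + - (y + z)
    flip = solve-∀
  reflect-adj c lvl (descend p i lvl′) =
    cube-adj-cong refl (cube-eq (flip (ca c) (ca p) _) (flip (cb c) (cb p) _) (flip (cc c) (cc p) _))
      (ascend (reflect c p) i (trans (reflect-level c p) (cong₂ _-_ lvl lvl′)))
    where
    flip : ∀ (x y z : ℤ) → x + - y + z ≡ x + - (y + - z)
    flip = solve-∀

  reflection : ∀ c → level c ≡ + 1 → CubeSymmetry c
  reflection c lvl = record
    { forth = reflect c
    ; back = reflect c
    ; back-forth = involutive
    ; forth-back = involutive
    ; forth-valid = reflect-valid
    ; back-valid = reflect-valid
    ; forth-adj = reflect-adj c lvl
    ; back-adj = reflect-adj c lvl
    ; forth-origin = cube-eq (ℤP.+-identityʳ (ca c)) (ℤP.+-identityʳ (cb c)) (ℤP.+-identityʳ (cc c)) }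
    where
    twice : ∀ (x y : ℤ) → x + - (x + - y) ≡ y
    twice = solve-∀
    involutive : ∀ p → reflect c (reflect c p) ≡ p
    involutive p = cube-eq (twice (ca c) (ca p)) (twice (cb c) (cb p)) (twice (cc c) (cc p))
    reflect-valid : ∀ {p} → Valid p → Valid (reflect c p)
    reflect-valid {p} (false , e) = true , trans (reflect-level c p) (cong₂ _-_ lvl e)
    reflect-valid {p} (true , e) = false , trans (reflect-level c p) (cong₂ _-_ lvl e)

  symmetry : ∀ c → Valid c → CubeSymmetry c
  symmetry c (false , lvl) = translation c lvl
  symmetry c (true , lvl) = reflection c lvl

  record Chart (v : Node) : Set where
    field
      toCube          : Node → Cube
      fromCube        : Cube → Node
      fromCube-toCube : ∀ u → fromCube (toCube u) ≡ u
      toCube-fromCube : ∀ p → Valid p → toCube (fromCube p) ≡ p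
      toCube-valid    : ∀ u → Valid (toCube u)
      toCube-adj      : ∀ {u w} → Adj u w → CubeAdj (toCube u) (toCube w)
      fromCube-adj    : ∀ {p q} → CubeAdj p q → Adj (fromCube p) (fromCube q)
      fromCube-origin : fromCube origin ≡ v

  -- (opaque: only the chart laws matter later, never its defining formulas)
  opaque
    chart : ∀ v → Chart v
    chart v = record
      { toCube = back ∘ toCube₀
      ; fromCube = fromCube₀ ∘ forth
      ; fromCube-toCube = λ u → trans (cong fromCube₀ (forth-back (toCube₀ u))) (fromCube₀-toCube₀ u)
      ; toCube-fromCube = λ p valid → trans (cong back (toCube₀-fromCube₀ (forth p) (forth-valid valid))) (back-forth p)
      ; toCube-valid = λ u → back-valid (toCube₀-valid u)
      ; toCube-adj = back-adj ∘ toCube₀-adj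
      ; fromCube-adj = fromCube₀-adj ∘ forth-adj
      ; fromCube-origin = trans (cong fromCube₀ forth-origin) (fromCube₀-toCube₀ v) }
      where open CubeSymmetry (symmetry (toCube₀ v) (toCube₀-valid v))

module Sectors where

  open Parity
  open CubeCoordinates
  open import Data.Nat as ℕ using (ℕ; zero; suc; _≤_; _<_; z≤n; s≤s)
  import Data.Nat.Properties as ℕP
  open import Data.Integer using (ℤ; +_; -[1+_]; +[1+_]; _+_; _-_; -_; ∣_∣; _⊖_)
  import Data.Integer.Properties as ℤP
  open import Data.Integer.Tactic.RingSolver using (solve-∀)
  open import Data.Bool using (Bool; true; false)
  open import Data.Fin.Patterns using (0F; 1F; 2F)
  open import Data.Maybe using (Maybe; just; nothing)
  open import Data.Product using (Σ; _×_; _,_)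
  open import Data.Empty using (⊥-elim)
  open import Relation.Binary.PropositionalEquality
  open import Relation.Nullary using (yes; no)

  -- The cube points with a ≥ 1 and c ≤ 0 form a sector,
  -- one of three congruent pieces of the graph minus the origin.
  lag : Bool → ℕ
  lag true = 0
  lag false = 1

  bit-lag : ∀ t → bitℤ t ≡ + 1 - + lag t
  bit-lag true = refl
  bit-lag false = refl

  Sector : Set
  Sector = Bool × ℕ × ℕ

  middle : Sector → ℤ
  middle (t , α , γ) = γ ⊖ (α ℕ.+ lag t)

  sector : Sector → Cube
  sector s@(t , α , γ) = ⟨ +[1+ α ] , middle s , - + γ ⟩

  -- the middle coordinate as an integer expression, ready for ring normalisation
  middle-difference : ∀ t α γ → middle (t , α , γ) ≡ + γ - + α - + lag t
  middle-difference t α γ = begin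
    γ ⊖ (α ℕ.+ lag t)       ≡⟨ ℤP.m-n≡m⊖n γ (α ℕ.+ lag t) ⟨
    + γ - + (α ℕ.+ lag t)   ≡⟨ cong (λ z → + γ - z) (ℤP.pos-+ α (lag t)) ⟩
    + γ - (+ α + + lag t)   ≡⟨ split (+ γ) (+ α) (+ lag t) ⟩
    + γ - + α - + lag t     ∎
    where
    open ≡-Reasoning
    split : ∀ (g a l : ℤ) → g - (a + l) ≡ g - a - l
    split = solve-∀

  middle-shift : ∀ t α γ t′ α′ γ′ δ → (+ γ - + α - + lag t) + δ ≡ + γ′ - + α′ - + lag t′ →
                 middle (t , α , γ) + δ ≡ middle (t′ , α′ , γ′)
  middle-shift t α γ t′ α′ γ′ δ eq =
    trans (cong (_+ δ) (middle-difference t α γ)) (trans eq (sym (middle-difference t′ α′ γ′)))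

  sector-level : ∀ t α γ → level (sector (t , α , γ)) ≡ bitℤ t
  sector-level t α γ = trans (cong (λ b → + 1 + + α + b + - + γ) (middle-difference t α γ)) (sum t)
    where
    collapse : ∀ (a g l : ℤ) → + 1 + a + (g - a - l) + - g ≡ + 1 - l
    collapse = solve-∀
    sum : ∀ t → + 1 + + α + (+ γ - + α - + lag t) + - + γ ≡ bitℤ t
    sum true = collapse (+ α) (+ γ) (+ 0)
    sum false = collapse (+ α) (+ γ) (+ 1)

  sector-norm : ∀ t α γ → norm (sector (t , α , γ)) ≡ suc α ℕ.+ ∣ middle (t , α , γ) ∣ ℕ.+ γ
  sector-norm t α γ = cong (suc α ℕ.+ ∣ middle (t , α , γ) ∣ ℕ.+_) (ℤP.∣-i∣≡∣i∣ (+ γ))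

  -- The parent of a sector point: a neighbour one step closer to the origin,
  -- inside the sector, or the origin itself (`nothing`) for the point ⟨ 1 , 0 , 0 ⟩.
  sector-parent : Sector → Maybe Sector
  sector-parent (true , α , γ) with α ℕ.<? γ
  ... | yes _ = just (false , α , γ)
  sector-parent (true , zero , γ) | no _ = nothing
  sector-parent (true , suc α , γ) | no _ = just (false , α , γ)
  sector-parent (false , α , zero) = just (true , α , 0)
  sector-parent (false , α , suc γ) = just (true , α , γ)

  toward : Maybe Sector → Cube
  toward nothing = origin
  toward (just s) = sector s

  -- Each parent step moves one coordinate one unit towards 0: b when b > 0
  -- (first case), else a at level 1, and else the negative coordinate b or c.
  sector-parent-step : ∀ s → ParentStep (sector s) (toward (sector-parent s))
  sector-parent-step (true , α , γ) with α ℕ.<? γ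
  ... | yes α<γ with ℕP.m≤n⇒∃[o]m+o≡n α<γ
  ...   | d , refl = step-descend 1F d (sector-level true α _) middle-positive
            (cube-eq (ℤP.+-identityʳ _) (middle-shift true α γ false α γ (- + 1) (one-less (+ α) (+ γ)))
                     (ℤP.+-identityʳ _))
    where
    one-less : ∀ (a g : ℤ) → g - a - + 0 + - + 1 ≡ g - a - + 1
    one-less = solve-∀
    middle-positive : suc α ℕ.+ d ⊖ (α ℕ.+ 0) ≡ +[1+ d ]
    middle-positive = trans (cong (_⊖ (α ℕ.+ 0)) (sym (ℕP.+-suc α d))) (ℤP.+-cancelˡ-⊖ α (suc d) 0)
  sector-parent-step (true , zero , zero) | no _ = step-descend 0F 0 refl refl refl
  sector-parent-step (true , zero , suc γ) | no 0≮γ = ⊥-elim (0≮γ (s≤s z≤n))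
  sector-parent-step (true , suc α , γ) | no _ =
    step-descend 0F (suc α) (sector-level true (suc α) γ) refl
      (cube-eq refl (middle-shift true (suc α) γ false α γ (+ 0) (borrow (+ α) (+ γ))) (ℤP.+-identityʳ _))
    where
    borrow : ∀ (a g : ℤ) → g - (+ 1 + a) - + 0 + + 0 ≡ g - a - + 1
    borrow = solve-∀
  sector-parent-step (false , α , zero) =
    step-ascend 1F α (sector-level false α 0) (trans (middle-difference false α 0) (negative (+ α)))
      (cube-eq (ℤP.+-identityʳ _) (middle-shift false α 0 true α 0 (+ 1) (one-more (+ α))) refl)
    where
    negative : ∀ (a : ℤ) → + 0 - a - + 1 ≡ - (+ 1 + a)
    negative = solve-∀
    one-more : ∀ (a : ℤ) → + 0 - a - + 1 + + 1 ≡ + 0 - a - + 0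
    one-more = solve-∀
  sector-parent-step (false , α , suc γ) =
    step-ascend 2F γ (sector-level false α (suc γ)) refl
      (cube-eq (ℤP.+-identityʳ _) (middle-shift false α (suc γ) true α γ (+ 0) (carry (+ α) (+ γ))) (shrink (+ γ)))
    where
    carry : ∀ (a g : ℤ) → (+ 1 + g) - a - + 1 + + 0 ≡ g - a - + 0
    carry = solve-∀
    shrink : ∀ (g : ℤ) → - (+ 1 + g) + + 1 ≡ - g
    shrink = solve-∀

  -- The index of a sector point within its layer (the points of equal norm).
  positive-part : ℤ → ℕ
  positive-part (+ n) = n
  positive-part -[1+ n ] = 0

  abs-via-positive-part : ∀ z → + ∣ z ∣ ≡ + positive-part z + + positive-part z - z
  abs-via-positive-part (+ n) = sym (self (+ n))
    where
    self : ∀ (x : ℤ) → x + x - x ≡ x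
    self = solve-∀
  abs-via-positive-part -[1+ n ] = refl

  positive-part≤abs : ∀ z → positive-part z ≤ ∣ z ∣
  positive-part≤abs (+ n) = ℕP.≤-refl
  positive-part≤abs -[1+ n ] = z≤n

  index : Sector → ℕ
  index s@(t , α , γ) = γ ℕ.+ positive-part (middle s)

  norm-halves : ∀ t α γ → let s = (t , α , γ) in
    + norm (sector s) ≡ (+ index s - middle s) + (+ index s - middle s) + bitℤ t
  norm-halves t α γ = begin
    + norm (sector s)                              ≡⟨ cong +_ (sector-norm t α γ) ⟩
    + (suc α ℕ.+ ∣ M ∣ ℕ.+ γ)                       ≡⟨ ℤP.pos-+ (suc α ℕ.+ ∣ M ∣) γ ⟩
    + (suc α ℕ.+ ∣ M ∣) + + γ                       ≡⟨ cong (_+ + γ) (ℤP.pos-+ (suc α) ∣ M ∣) ⟩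
    + 1 + + α + + ∣ M ∣ + + γ                        ≡⟨ cong (λ z → + 1 + + α + z + + γ) (abs-via-positive-part M) ⟩
    + 1 + + α + (+ P + + P - M) + + γ                ≡⟨ cong (λ m → + 1 + + α + (+ P + + P - m) + + γ) (middle-difference t α γ) ⟩
    + 1 + + α + (+ P + + P - D) + + γ                ≡⟨ regroup (+ α) (+ γ) (+ P) (+ lag t) ⟩
    (+ γ + + P - D) + (+ γ + + P - D) + (+ 1 - + lag t) ≡⟨ cong (λ m → (+ γ + + P - m) + (+ γ + + P - m) + (+ 1 - + lag t)) (middle-difference t α γ) ⟨
    (+ γ + + P - M) + (+ γ + + P - M) + (+ 1 - + lag t) ≡⟨ cong₂ (λ i b → (i - M) + (i - M) + b) (ℤP.pos-+ γ P) (bit-lag t) ⟨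
    (+ index s - M) + (+ index s - M) + bitℤ t      ∎
    where
    open ≡-Reasoning
    s = (t , α , γ)
    M = middle s
    P = positive-part M
    D = + γ - + α - + lag t
    regroup : ∀ (a g p l : ℤ) → + 1 + a + (p + p - (g - a - l)) + g ≡
              (g + p - (g - a - l)) + (g + p - (g - a - l)) + (+ 1 - l)
    regroup = solve-∀

  sector-injective : ∀ s s′ → norm (sector s) ≡ norm (sector s′) → index s ≡ index s′ → s ≡ s′
  sector-injective s@(t , α , γ) s′@(t′ , α′ , γ′) same-norm same-index
    with halving-unique {+ index s - middle s} {t} {+ index s′ - middle s′} {t′}
           (trans (sym (norm-halves t α γ)) (trans (cong +_ same-norm) (norm-halves t′ α′ γ′)))
  ... | same-half , refl = cong₂ (λ a g → t , a , g) same-α same-γ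
    where
    same-middle : middle s ≡ middle s′
    same-middle = trans (recover (+ index s) (middle s))
      (trans (cong₂ _-_ (cong +_ same-index) same-half) (sym (recover (+ index s′) (middle s′))))
      where
      recover : ∀ (i m : ℤ) → m ≡ i - (i - m)
      recover = solve-∀
    same-γ : γ ≡ γ′
    same-γ = ℕP.+-cancelʳ-≡ (positive-part (middle s)) γ γ′
               (trans same-index (cong (λ m → γ′ ℕ.+ positive-part m) (sym same-middle)))
    same-α : α ≡ α′
    same-α = ℤP.+-injective (trans (solve-for-α (+ γ) (+ α) (+ lag t))
      (trans (cong₂ (λ g d → g - d - + lag t) (cong +_ same-γ)
                    (trans (sym (middle-difference t α γ)) (trans same-middle (middle-difference t α′ γ′))))
             (sym (solve-for-α (+ γ′) (+ α′) (+ lag t)))))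
      where
      solve-for-α : ∀ (g a l : ℤ) → a ≡ g - (g - a - l) - l
      solve-for-α = solve-∀

  -- so a layer of norm n has at most n points
  index<norm : ∀ s → index s < norm (sector s)
  index<norm s@(t , α , γ) = begin-strict
    γ ℕ.+ positive-part M       ≡⟨ ℕP.+-comm γ (positive-part M) ⟩
    positive-part M ℕ.+ γ       <⟨ ℕP.+-monoˡ-< γ (s≤s (ℕP.≤-trans (positive-part≤abs M) (ℕP.m≤n+m ∣ M ∣ α))) ⟩
    suc α ℕ.+ ∣ M ∣ ℕ.+ γ       ≡⟨ sector-norm t α γ ⟨
    norm (sector s)             ∎
    where
    open ℕP.≤-Reasoning
    M = middle s

  -- Layers.  Writing m = h + h + lag t, the sector points of norm m + 1 are the
  -- points layer h t i, i ≤ m, the i-th of which has index i.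
  layer-shape : ∀ m → Σ ℕ λ h → Σ Bool λ t → m ≡ h ℕ.+ h ℕ.+ lag t
  layer-shape zero = 0 , true , refl
  layer-shape (suc zero) = 0 , false , refl
  layer-shape (suc (suc m)) with layer-shape m
  ... | h , t , refl = suc h , t , cong (ℕ._+ lag t) (sym (cong suc (ℕP.+-suc h h)))

  layer : ℕ → Bool → ℕ → Sector
  layer h t i with i ℕ.<? h ℕ.+ lag t
  ... | yes _ = t , h , i
  ... | no _ = t , h ℕ.+ h ℕ.+ lag t ℕ.∸ i , h ℕ.+ lag t

  pos-∸ : ∀ {m n} → n ≤ m → + (m ℕ.∸ n) ≡ + m - + n
  pos-∸ {m} {n} n≤m = sym (trans (ℤP.m-n≡m⊖n m n) (ℤP.⊖-≥ n≤m))

  -- on the near side of a layer the middle coordinate is negative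
  positive-part-neg : ∀ n → positive-part (- + n) ≡ 0
  positive-part-neg zero = refl
  positive-part-neg (suc n) = refl

  far-middle : ∀ h t i → h ℕ.+ lag t ≤ i → i ≤ h ℕ.+ h ℕ.+ lag t →
               middle (t , h ℕ.+ h ℕ.+ lag t ℕ.∸ i , h ℕ.+ lag t) ≡ + (i ℕ.∸ (h ℕ.+ lag t))
  far-middle h t i g≤i i≤m = begin
    middle (t , m ℕ.∸ i , g)               ≡⟨ middle-difference t (m ℕ.∸ i) g ⟩
    + g - + (m ℕ.∸ i) - + lag t            ≡⟨ cong₂ (λ x y → x - y - + lag t) (ℤP.pos-+ h (lag t)) (pos-∸ i≤m) ⟩
    + h + + lag t - (+ m - + i) - + lag t   ≡⟨ cong (λ x → + h + + lag t - (x - + i) - + lag t) m≡ ⟩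
    + h + + lag t - (+ h + + h + + lag t - + i) - + lag t  ≡⟨ regroup (+ h) (+ lag t) (+ i) ⟩
    + i - (+ h + + lag t)                  ≡⟨ cong (λ x → + i - x) (ℤP.pos-+ h (lag t)) ⟨
    + i - + g                              ≡⟨ pos-∸ g≤i ⟨
    + (i ℕ.∸ g)                            ∎
    where
    open ≡-Reasoning
    g = h ℕ.+ lag t
    m = h ℕ.+ h ℕ.+ lag t
    m≡ : + m ≡ + h + + h + + lag t
    m≡ = trans (ℤP.pos-+ (h ℕ.+ h) (lag t)) (cong (_+ + lag t) (ℤP.pos-+ h h))
    regroup : ∀ (h l i : ℤ) → h + l - (h + h + l - i) - l ≡ i - (h + l)
    regroup = solve-∀

  layer-norm : ∀ h t i → i ≤ h ℕ.+ h ℕ.+ lag t → norm (sector (layer h t i)) ≡ suc (h ℕ.+ h ℕ.+ lag t)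
  layer-norm h t i i≤m with i ℕ.<? h ℕ.+ lag t
  ... | yes i<g = begin
    norm (sector (t , h , i))               ≡⟨ sector-norm t h i ⟩
    suc h ℕ.+ ∣ i ⊖ g ∣ ℕ.+ i               ≡⟨ cong (λ d → suc h ℕ.+ d ℕ.+ i) (ℤP.∣⊖∣-< i<g) ⟩
    suc h ℕ.+ (g ℕ.∸ i) ℕ.+ i               ≡⟨ ℕP.+-assoc (suc h) (g ℕ.∸ i) i ⟩
    suc h ℕ.+ (g ℕ.∸ i ℕ.+ i)               ≡⟨ cong (suc h ℕ.+_) (ℕP.m∸n+n≡m (ℕP.<⇒≤ i<g)) ⟩
    suc h ℕ.+ g                             ≡⟨ cong suc (ℕP.+-assoc h h (lag t)) ⟨
    suc (h ℕ.+ h ℕ.+ lag t)                 ∎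
    where
    open ≡-Reasoning
    g = h ℕ.+ lag t
  ... | no i≮g = begin
    norm (sector (t , m ℕ.∸ i , g))             ≡⟨ sector-norm t (m ℕ.∸ i) g ⟩
    suc (m ℕ.∸ i) ℕ.+ ∣ middle (t , m ℕ.∸ i , g) ∣ ℕ.+ g  ≡⟨ cong (λ z → suc (m ℕ.∸ i) ℕ.+ ∣ z ∣ ℕ.+ g) (far-middle h t i (ℕP.≮⇒≥ i≮g) i≤m) ⟩
    suc (m ℕ.∸ i) ℕ.+ (i ℕ.∸ g) ℕ.+ g          ≡⟨ cong suc (ℕP.+-assoc (m ℕ.∸ i) (i ℕ.∸ g) g) ⟩
    suc (m ℕ.∸ i ℕ.+ (i ℕ.∸ g ℕ.+ g))          ≡⟨ cong (λ z → suc (m ℕ.∸ i ℕ.+ z)) (ℕP.m∸n+n≡m (ℕP.≮⇒≥ i≮g)) ⟩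
    suc (m ℕ.∸ i ℕ.+ i)                        ≡⟨ cong suc (ℕP.m∸n+n≡m i≤m) ⟩
    suc m                                      ∎
    where
    open ≡-Reasoning
    g = h ℕ.+ lag t
    m = h ℕ.+ h ℕ.+ lag t

  layer-index : ∀ h t i → i ≤ h ℕ.+ h ℕ.+ lag t → index (layer h t i) ≡ i
  layer-index h t i i≤m with i ℕ.<? h ℕ.+ lag t
  ... | yes i<g = trans (cong (λ d → i ℕ.+ positive-part d) (ℤP.⊖-< i<g))
                        (trans (cong (i ℕ.+_) (positive-part-neg (h ℕ.+ lag t ℕ.∸ i))) (ℕP.+-identityʳ i))
  ... | no i≮g = trans (cong (λ d → h ℕ.+ lag t ℕ.+ positive-part d) (far-middle h t i (ℕP.≮⇒≥ i≮g) i≤m))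
                       (ℕP.m+[n∸m]≡n (ℕP.≮⇒≥ i≮g))

  layer-point : ℕ → ℕ → Sector
  layer-point m i with layer-shape m
  ... | h , t , _ = layer h t i

  layer-point-norm : ∀ m i → i ≤ m → norm (sector (layer-point m i)) ≡ suc m
  layer-point-norm m i i≤m with layer-shape m
  ... | h , t , refl = layer-norm h t i i≤m

  layer-point-index : ∀ m i → i ≤ m → index (layer-point m i) ≡ i
  layer-point-index m i i≤m with layer-shape m
  ... | h , t , refl = layer-index h t i i≤m

module Codes where

  open Parity
  open CubeCoordinates
  open Sectors
  open import Data.Nat as ℕ using (ℕ; zero; suc; _<_)
  import Data.Nat.Properties as ℕP
  open import Data.Integer using (ℤ; +_; -[1+_]; +[1+_]; _+_; _-_; -_)
  import Data.Integer.Properties as ℤP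
  open import Data.Integer.Tactic.RingSolver using (solve-∀)
  open import Data.Bool using (Bool; true; false)
  open import Data.Fin using (Fin)
  open import Data.Fin.Patterns using (0F; 1F; 2F)
  open import Data.Maybe using (Maybe; just; nothing)
  open import Data.Product using (_×_; _,_)
  open import Data.Empty using (⊥-elim)
  open import Relation.Binary.PropositionalEquality

  -- The three sectors are the images of the first one under the rotations.
  turn : Fin 3 → Cube → Cube
  turn 0F p = p
  turn 1F p = rotate p
  turn 2F p = rotate (rotate p)

  turn-level : ∀ β p → level (turn β p) ≡ level p
  turn-level 0F p = refl
  turn-level 1F p = rotate-level p
  turn-level 2F p = trans (rotate-level (rotate p)) (rotate-level p)

  turn-norm : ∀ β p → norm (turn β p) ≡ norm p
  turn-norm 0F p = refl
  turn-norm 1F p = rotate-norm p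
  turn-norm 2F p = trans (rotate-norm (rotate p)) (rotate-norm p)

  turn-step : ∀ β {p q} → ParentStep p q → ParentStep (turn β p) (turn β q)
  turn-step β {p} {q} p→q = record
    { edge = turn-adj β (ParentStep.edge p→q)
    ; closer = trans (cong suc (turn-norm β q)) (trans (ParentStep.closer p→q) (sym (turn-norm β p))) }
    where
    turn-adj : ∀ β {p q} → CubeAdj p q → CubeAdj (turn β p) (turn β q)
    turn-adj 0F a = a
    turn-adj 1F a = rotate-adj a
    turn-adj 2F a = rotate-adj (rotate-adj a)

  turn-origin : ∀ β → turn β origin ≡ origin
  turn-origin 0F = refl
  turn-origin 1F = refl
  turn-origin 2F = refl

  data Code : Set where
    centre : Code
    branch : Fin 3 → Sector → Code

  embed : Code → Cube
  embed centre = origin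
  embed (branch β s) = turn β (sector s)

  embed-valid : ∀ c → Valid (embed c)
  embed-valid centre = false , refl
  embed-valid (branch β (t , α , γ)) = t , trans (turn-level β (sector _)) (sector-level t α γ)

  level-bit : ℤ → Bool
  level-bit (+ 1) = true
  level-bit _ = false

  level-bit-bitℤ : ∀ t → level-bit (bitℤ t) ≡ t
  level-bit-bitℤ true = refl
  level-bit-bitℤ false = refl

  -- Every nonzero valid point lies in exactly one sector: some coordinate is
  -- positive while its cyclic predecessor is not.
  classify : Cube → Code
  classify p@(⟨ +[1+ α ] , b , + zero ⟩) = branch 0F (level-bit (level p) , α , 0)
  classify p@(⟨ +[1+ α ] , b , -[1+ γ ] ⟩) = branch 0F (level-bit (level p) , α , suc γ)
  classify p@(⟨ + zero , +[1+ α ] , c ⟩) = branch 1F (level-bit (level p) , α , 0)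
  classify p@(⟨ -[1+ γ ] , +[1+ α ] , c ⟩) = branch 1F (level-bit (level p) , α , suc γ)
  classify p@(⟨ a , + zero , +[1+ α ] ⟩) = branch 2F (level-bit (level p) , α , 0)
  classify p@(⟨ a , -[1+ γ ] , +[1+ α ] ⟩) = branch 2F (level-bit (level p) , α , suc γ)
  classify _ = centre

  bit-of-turn : ∀ β t α γ → level-bit (level (turn β (sector (t , α , γ)))) ≡ t
  bit-of-turn β t α γ = trans (cong level-bit (trans (turn-level β _) (sector-level t α γ))) (level-bit-bitℤ t)

  -- the third sector puts the middle coordinate first, so classify needs it split
  classify-third : ∀ b γ α → classify ⟨ b , - + γ , +[1+ α ] ⟩ ≡
                   branch 2F (level-bit (level ⟨ b , - + γ , +[1+ α ] ⟩) , α , γ)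
  classify-third (+ zero) zero α = refl
  classify-third (+ zero) (suc γ) α = refl
  classify-third +[1+ n ] zero α = refl
  classify-third +[1+ n ] (suc γ) α = refl
  classify-third -[1+ n ] zero α = refl
  classify-third -[1+ n ] (suc γ) α = refl

  classify-embed : ∀ c → classify (embed c) ≡ c
  classify-embed centre = refl
  classify-embed (branch 0F (t , α , zero)) = cong (λ b → branch 0F (b , α , 0)) (bit-of-turn 0F t α 0)
  classify-embed (branch 0F (t , α , suc γ)) = cong (λ b → branch 0F (b , α , suc γ)) (bit-of-turn 0F t α (suc γ))
  classify-embed (branch 1F (t , α , zero)) = cong (λ b → branch 1F (b , α , 0)) (bit-of-turn 1F t α 0)
  classify-embed (branch 1F (t , α , suc γ)) = cong (λ b → branch 1F (b , α , suc γ)) (bit-of-turn 1F t α (suc γ))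
  classify-embed (branch 2F (t , α , γ)) =
    trans (classify-third (middle (t , α , γ)) γ α) (cong (λ b → branch 2F (b , α , γ)) (bit-of-turn 2F t α γ))

  sector-recover : ∀ α b γ → Valid ⟨ +[1+ α ] , b , - + γ ⟩ →
    sector (level-bit (level ⟨ +[1+ α ] , b , - + γ ⟩) , α , γ) ≡ ⟨ +[1+ α ] , b , - + γ ⟩
  sector-recover α b γ (t , lvl) =
    trans (cong (λ bit → sector (bit , α , γ)) (trans (cong level-bit lvl) (level-bit-bitℤ t)))
          (cube-eq refl (trans (middle-difference t α γ) solve-middle) refl)
    where
    solve-middle : + γ - + α - + lag t ≡ b
    solve-middle = begin
      + γ - + α - + lag t                            ≡⟨ through-level (+ α) (+ γ) (+ lag t) ⟩
      (+ 1 - + lag t) - (+ 1 + + α) + + γ              ≡⟨ cong (λ l → l - (+ 1 + + α) + + γ) (trans (sym (bit-lag t)) (sym lvl)) ⟩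
      (+ 1 + + α + b + - + γ) - (+ 1 + + α) + + γ      ≡⟨ isolate (+ α) b (+ γ) ⟩
      b                                              ∎
      where
      open ≡-Reasoning
      through-level : ∀ (a g l : ℤ) → g - a - l ≡ (+ 1 - l) - (+ 1 + a) + g
      through-level = solve-∀
      isolate : ∀ (a b g : ℤ) → (+ 1 + a + b + - g) - (+ 1 + a) + g ≡ b
      isolate = solve-∀

  sector-recover-turned : ∀ β α b γ → Valid (turn β ⟨ +[1+ α ] , b , - + γ ⟩) →
    turn β (sector (level-bit (level (turn β ⟨ +[1+ α ] , b , - + γ ⟩)) , α , γ)) ≡ turn β ⟨ +[1+ α ] , b , - + γ ⟩
  sector-recover-turned β α b γ (t , lvl) = cong (turn β)
    (trans (cong (λ bit → sector (level-bit bit , α , γ)) (turn-level β q))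
           (sector-recover α b γ (t , trans (sym (turn-level β q)) lvl)))
    where
    q = ⟨ +[1+ α ] , b , - + γ ⟩

  too-low : ∀ n t → -[1+ n ] ≢ bitℤ t
  too-low n false ()
  too-low n true ()

  too-high : ∀ a b c t → +[1+ a ] + +[1+ b ] + +[1+ c ] ≢ bitℤ t
  too-high a b c false ()
  too-high a b c true eq = ℕP.m+1+n≢0 (a ℕ.+ suc b) (ℕP.suc-injective (ℤP.+-injective eq))

  embed-classify : ∀ p → Valid p → embed (classify p) ≡ p
  embed-classify ⟨ +[1+ α ] , b , + zero ⟩ v = sector-recover α b 0 v
  embed-classify ⟨ +[1+ α ] , b , -[1+ γ ] ⟩ v = sector-recover α b (suc γ) v
  embed-classify ⟨ + zero , +[1+ α ] , c ⟩ v = sector-recover-turned 1F α c 0 v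
  embed-classify ⟨ -[1+ γ ] , +[1+ α ] , c ⟩ v = sector-recover-turned 1F α c (suc γ) v
  embed-classify ⟨ a , + zero , +[1+ α ] ⟩ v = trans (cong embed (classify-third a 0 α)) (sector-recover-turned 2F α a 0 v)
  embed-classify ⟨ a , -[1+ γ ] , +[1+ α ] ⟩ v =
    trans (cong embed (classify-third a (suc γ) α)) (sector-recover-turned 2F α a (suc γ) v)
  embed-classify ⟨ +[1+ a ] , +[1+ b ] , +[1+ c ] ⟩ (t , lvl) = ⊥-elim (too-high a b c t lvl)
  embed-classify ⟨ + zero , + zero , + zero ⟩ _ = refl
  embed-classify ⟨ + zero , + zero , -[1+ _ ] ⟩ (t , lvl) = ⊥-elim (too-low _ t lvl)
  embed-classify ⟨ + zero , -[1+ _ ] , + zero ⟩ (t , lvl) = ⊥-elim (too-low _ t lvl)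
  embed-classify ⟨ + zero , -[1+ _ ] , -[1+ _ ] ⟩ (t , lvl) = ⊥-elim (too-low _ t lvl)
  embed-classify ⟨ -[1+ _ ] , + zero , + zero ⟩ (t , lvl) = ⊥-elim (too-low _ t lvl)
  embed-classify ⟨ -[1+ _ ] , + zero , -[1+ _ ] ⟩ (t , lvl) = ⊥-elim (too-low _ t lvl)
  embed-classify ⟨ -[1+ _ ] , -[1+ _ ] , + zero ⟩ (t , lvl) = ⊥-elim (too-low _ t lvl)
  embed-classify ⟨ -[1+ _ ] , -[1+ _ ] , -[1+ _ ] ⟩ (t , lvl) = ⊥-elim (too-low _ t lvl)

  lift : Fin 3 → Maybe Sector → Code
  lift β nothing = centre
  lift β (just s) = branch β s

  parent-code : Code → Code
  parent-code centre = centre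
  parent-code (branch β s) = lift β (sector-parent s)

  parent-code-adj : ∀ c → 0 < norm (embed c) → CubeAdj (embed c) (embed (parent-code c))
  parent-code-adj (branch β s) _ = subst (CubeAdj _) (sym (embed-lift (sector-parent s)))
                                         (ParentStep.edge (turn-step β (sector-parent-step s)))
    where
    embed-lift : ∀ m → embed (lift β m) ≡ turn β (toward m)
    embed-lift nothing = sym (turn-origin β)
    embed-lift (just s) = refl

  norm-parent-code : ∀ c → norm (embed (parent-code c)) ≡ norm (embed c) ℕ.∸ 1
  norm-parent-code centre = refl
  norm-parent-code (branch β s) with sector-parent s | turn-step β (sector-parent-step s)
  ... | nothing | parent-step =
    cong (ℕ._∸ 1) (trans (cong (λ p → suc (norm p)) (sym (turn-origin β))) (ParentStep.closer parent-step))
  ... | just s′ | parent-step = cong (ℕ._∸ 1) (ParentStep.closer parent-step)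

  -- the sector of a code (the centre is given sector 0 arbitrarily)
  sector-of : Code → Fin 3
  sector-of centre = 0F
  sector-of (branch β _) = β

  sector-of-parent : ∀ c → 0 < norm (embed (parent-code c)) → sector-of (parent-code c) ≡ sector-of c
  sector-of-parent centre _ = refl
  sector-of-parent (branch β s) pos with sector-parent s
  ... | nothing = ⊥-elim (ℕP.<-irrefl refl pos)
  ... | just _ = refl

  index-code : Code → ℕ
  index-code centre = 0
  index-code (branch β s) = index s

  index<norm-code : ∀ c → 0 < norm (embed c) → index-code c < norm (embed c)
  index<norm-code (branch β s) _ = subst (index s <_) (sym (turn-norm β (sector s))) (index<norm s)

  code-injective : ∀ c c′ → 0 < norm (embed c) → 0 < norm (embed c′) → sector-of c ≡ sector-of c′ →
                   norm (embed c) ≡ norm (embed c′) → index-code c ≡ index-code c′ → c ≡ c′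
  code-injective (branch β s) (branch .β s′) _ _ refl same-norm same-index =
    cong (branch β) (sector-injective s s′
      (trans (sym (turn-norm β (sector s))) (trans same-norm (turn-norm β (sector s′)))) same-index)

  branch-injective : ∀ {β β′ s s′} → branch β s ≡ branch β′ s′ → β ≡ β′ × s ≡ s′
  branch-injective refl = refl , refl

module Honeycomb (v : Node) where

  open Triangle
  open Routing
  open CubeCoordinates
  open Charts
  open Sectors
  open Codes
  open import Data.Nat as ℕ using (ℕ; suc; _+_; _≤_; _<_; z≤n; s≤s)
  import Data.Nat.Properties as ℕP
  open import Data.Bool using (false)
  open import Data.Fin using (Fin; toℕ)
  import Data.Fin.Properties as FinP
  open import Data.Product using (Σ; _,_)
  open import Function using (_∘_)
  open import Relation.Binary.PropositionalEquality

  open Chart (chart v)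

  code : Node → Code
  code w = classify (toCube w)

  node : Code → Node
  node c = fromCube (embed c)

  node-code : ∀ w → node (code w) ≡ w
  node-code w = trans (cong fromCube (embed-classify (toCube w) (toCube-valid w))) (fromCube-toCube w)

  code-node : ∀ c → code (node c) ≡ c
  code-node c = trans (cong classify (toCube-fromCube (embed c) (embed-valid c))) (classify-embed c)

  toCube-root : toCube v ≡ origin
  toCube-root = trans (cong toCube (sym fromCube-origin)) (toCube-fromCube origin (false , refl))

  height : Node → ℕ
  height w = norm (toCube w)

  height-code : ∀ w → height w ≡ norm (embed (code w))
  height-code w = cong norm (sym (embed-classify (toCube w) (toCube-valid w)))

  height-node : ∀ c → height (node c) ≡ norm (embed c)
  height-node c = cong norm (toCube-fromCube (embed c) (embed-valid c))

  tree : DistanceTree v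
  tree = record
    { height = height
    ; parent = node ∘ parent-code ∘ code
    ; root = λ w h≡0 → trans (sym (fromCube-toCube w)) (trans (cong fromCube (norm-zero _ h≡0)) fromCube-origin)
    ; parent-root = trans (cong (node ∘ parent-code ∘ classify) toCube-root) fromCube-origin
    ; parent-adj = λ w 0<h → subst (λ u → Adj u (node (parent-code (code w)))) (node-code w)
        (fromCube-adj (parent-code-adj (code w) (subst (0 <_) (height-code w) 0<h)))
    ; height-parent = λ w → trans (height-node (parent-code (code w)))
        (trans (norm-parent-code (code w)) (cong (ℕ._∸ 1) (sym (height-code w))))
    ; height-adj = λ a → norm-adj (toCube-adj a) }

  open DistanceTree tree using (height-packet; packet-height)

  slot : Node → ℕ
  slot w = suc (tri (ℕ.pred (height w)) ℕ.+ index-code (code w))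

  index≤height-1 : ∀ w → 0 < height w → index-code (code w) ≤ ℕ.pred (height w)
  index≤height-1 w 0<h = ℕP.<⇒≤pred (subst (index-code (code w) <_) (sym (height-code w))
                           (index<norm-code (code w) (subst (0 <_) (height-code w) 0<h)))

  -- Within a sector, nodes are scheduled layer by layer, so slots are distinct.
  timetable : Timetable tree (Fin 3)
  timetable = record
    { colour = sector-of ∘ code
    ; slot = slot
    ; colour-parent = λ w 0<h → trans (cong sector-of (code-node (parent-code (code w))))
        (sector-of-parent (code w) (subst (0 <_) (height-node (parent-code (code w))) 0<h))
    ; height≤slot = λ w → height≤slot-shape (height w) (index-code (code w))
    ; slot-injective = slot-injective }
    where
    slot-injective : ∀ w w′ → 0 < height w → 0 < height w′ → sector-of (code w) ≡ sector-of (code w′) →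
                     slot w ≡ slot w′ → w ≡ w′
    slot-injective w w′ 0<h 0<h′ same-sector same-slot
      with triangle-injective (index≤height-1 w 0<h) (index≤height-1 w′ 0<h′) (ℕP.suc-injective same-slot)
    ... | same-row , same-index = trans (sym (node-code w)) (trans (cong node same-code) (node-code w′))
      where
      same-height : height w ≡ height w′
      same-height = trans (sym (ℕP.suc-pred (height w) {{ℕ.>-nonZero 0<h}}))
                          (trans (cong suc same-row) (ℕP.suc-pred (height w′) {{ℕ.>-nonZero 0<h′}}))
      same-code : code w ≡ code w′
      same-code = code-injective (code w) (code w′)
        (subst (0 <_) (height-code w) 0<h) (subst (0 <_) (height-code w′) 0<h′) same-sector
        (trans (sym (height-code w)) (trans same-height (height-code w′))) same-index

  slot≤tri : ∀ {r} w → HasPacket v r w → slot w ≤ tri r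
  slot≤tri {r} w has-packet with packet-height has-packet
  ... | 1≤h , h≤r = slot≤tri-shape (index≤height-1 w 1≤h)
        (subst (_≤ r) (sym (ℕP.suc-pred (height w) {{ℕ.>-nonZero 1≤h}})) h≤r)

  neighbour : Fin 3 → Node
  neighbour i = fromCube (origin ⊕ unit i)

  adj-neighbour : ∀ {X} → Adj X v → Σ (Fin 3) λ i → X ≡ neighbour i
  adj-neighbour {X} a with from-origin (cube-adj-cong toCube-root refl (toCube-adj (Adj-sym a)))
  ... | i , toCube≡ = i , trans (sym (fromCube-toCube X)) (cong fromCube toCube≡)

  -- 3 · tri r packets: in each sector, the layer points of the cells of the
  -- first r rows of the triangle
  cell : ∀ r (j : Fin (tri r)) → Cell r (toℕ j)
  cell r j = triangle-surjective r (toℕ j) (FinP.toℕ<n j)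

  packet : ∀ r → Fin (tri r) × Fin 3 → Node
  packet r (j , β) = node (branch β (layer-point (Cell.row (cell r j)) (Cell.column (cell r j))))

  height-of-packet : ∀ r j β → height (packet r (j , β)) ≡ suc (Cell.row (cell r j))
  height-of-packet r j β = trans (height-node (branch β _))
    (trans (turn-norm β _) (layer-point-norm _ _ (Cell.column≤row (cell r j))))

  packet-has : ∀ r p → HasPacket v r (packet r p)
  packet-has r (j , β) = height-packet
    (subst (1 ≤_) (sym (height-of-packet r j β)) (s≤s z≤n))
    (subst (_≤ r) (sym (height-of-packet r j β)) (Cell.row<r (cell r j)))

  packet-injective : ∀ r p q → packet r p ≡ packet r q → p ≡ q
  packet-injective r (j , β) (j′ , β′) same-node
    with trans (sym (code-node _)) (trans (cong code same-node) (code-node _))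
  ... | same-code with branch-injective same-code
  ...   | refl , same-point = cong (_, β) (FinP.toℕ-injective (begin
    toℕ j                 ≡⟨ Cell.position c ⟨
    tri m + i             ≡⟨ cong₂ (λ m i → tri m + i) same-row same-column ⟩
    tri m′ + i′           ≡⟨ Cell.position c′ ⟩
    toℕ j′                ∎))
    where
    open ≡-Reasoning
    c = cell r j
    c′ = cell r j′
    m = Cell.row c
    i = Cell.column c
    m′ = Cell.row c′
    i′ = Cell.column c′
    same-row : m ≡ m′
    same-row = ℕP.suc-injective (trans (sym (layer-point-norm m i (Cell.column≤row c)))
      (trans (cong (norm ∘ sector) same-point) (layer-point-norm m′ i′ (Cell.column≤row c′))))
    same-column : i ≡ i′
    same-column = trans (sym (layer-point-index m i (Cell.column≤row c)))
      (trans (cong index same-point) (layer-point-index m′ i′ (Cell.column≤row c′)))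

mainTheorem7 : (v : Node) (r : ℕ) → 1 ≤ r →
    Σ (Schedule v r) (λ s → Delivers s (suc r C 2))
    × ((s : Schedule v r) (T : ℕ) → Delivers s T → suc r C 2 ≤ T)
mainTheorem7 v r _ = (tree-schedule r , on-time) , at-least
  where
  open Triangle using (tri; tri≡C)
  open Routing using (Timetable; lower-bound)
  open Honeycomb v
  open Timetable timetable using (tree-schedule; tree-schedule-delivers)
  on-time : Delivers (tree-schedule r) (suc r C 2)
  on-time = subst (Delivers (tree-schedule r)) (sym (tri≡C r)) (tree-schedule-delivers r (tri r) slot≤tri)
  at-least : ∀ s T → Delivers s T → suc r C 2 ≤ T
  at-least s T delivers = subst (_≤ T) (sym (tri≡C r))
    (lower-bound neighbour adj-neighbour (packet r) (packet-injective r) (packet-has r) s delivers)
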